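{- Let the parsing scheme be either LZD or LZMW, and let $s\in\Sigma^*$. Then there exist a string $t\in\{0,1\}^*$ of length $\Theta(|\Sigma|\log|\Sigma|)$ and a morphism $\phi:\Sigma^*\to\{0,1\}^*$ with $\phi(\Sigma)\subseteq\{0,1\}^{\ell}$ for some $\ell=\Theta(\log|\Sigma|)$ such that the parsing (in the chosen scheme) of $t\cdot\phi(s)$ consists of the parsing of $t$ followed by the image under $\phi$ of the parsing of $s$, i.e., if $s=p_1\cdots p_z$ is the parsing of $s$ and $t=q_1\cdots q_m$ is the parsing of $t$, then the parsing of $t\phi(s)$ is $q_1,\dots,q_m,\phi(p_1),\dots,\phi(p_z)$.
   Context: LZD parsing of a string $s[1..n]$: $s=p_1\cdots p_z$, where with $k=|p_1\cdots p_{i-1}|+1$, $p_i=p_{i_1}p_{i_2}$ with $p_{i_1}$ the longest prefix of $s[k..n]$ in $\{p_1,\dots,p_{i-1}\}\cup\Sigma$ and $p_{i_2}$ the longest prefix of $s[k+|p_{i_1}|..n]$ in $\{p_1,\dots,p_{i-1}\}\cup\Sigma$ (here $\Sigma$ is the alphabet of the string being parsed). LZMW parsing: $p_i$ is the longest prefix of $s[k..n]$ in $\{p_jp_{j+1}:1\le j\le i-2\}\cup\Sigma$. A morphism $\phi$ satisfies $\phi(xy)=\phi(x)\phi(y)$, and $\phi$ applied to a parsing means applying it to each phrase. -}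

module Defs where

open import Data.Nat using (ℕ; _≤_)
open import Data.List using (List; []; _∷_; _++_; length; _∷ʳ_)
open import Data.List.Membership.Propositional using (_∈_)
open import Data.Product using (Σ; ∃; _×_; _,_)
open import Data.Sum using (_⊎_)
open import Relation.Binary.PropositionalEquality using (_≡_)

Prefix : {A : Set} → List A → List A → Set
Prefix {A} x r = Σ (List A) λ w → x ++ w ≡ r

LongestPrefix : {A : Set} → (List A → Set) → List A → List A → Set
LongestPrefix D r x =
  D x × Prefix x r × (∀ y → D y → Prefix y r → length y ≤ length x)

-- same, but the empty string is the answer when r is empty
-- (used for the second factor of the last LZD phrase)
LongestPrefix₀ : {A : Set} → (List A → Set) → List A → List A → Set
LongestPrefix₀ D r x = (r ≡ [] × x ≡ []) ⊎ LongestPrefix D r x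

IsLetter : {A : Set} → List A → Set
IsLetter {A} x = ∃ λ (c : A) → x ≡ c ∷ []

DictLZD : {A : Set} → List (List A) → List A → Set
DictLZD prev x = x ∈ prev ⊎ IsLetter x

adjPairs : {A : Set} → List (List A) → List (List A)
adjPairs []            = []
adjPairs (p ∷ [])      = []
adjPairs (p ∷ q ∷ ps)  = (p ++ q) ∷ adjPairs (q ∷ ps)

DictLZMW : {A : Set} → List (List A) → List A → Set
DictLZMW prev x = x ∈ adjPairs prev ⊎ IsLetter x

data LZDFrom {A : Set} (prev : List (List A)) : List A → List (List A) → Set where
  done : LZDFrom prev [] []
  step : ∀ (x y r : List A) (ps : List (List A))
       → LongestPrefix (DictLZD prev) (x ++ y ++ r) x
       → LongestPrefix₀ (DictLZD prev) (y ++ r) y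
       → LZDFrom (prev ∷ʳ (x ++ y)) r ps
       → LZDFrom prev (x ++ y ++ r) ((x ++ y) ∷ ps)

data LZMWFrom {A : Set} (prev : List (List A)) : List A → List (List A) → Set where
  done : LZMWFrom prev [] []
  step : ∀ (x r : List A) (ps : List (List A))
       → LongestPrefix (DictLZMW prev) (x ++ r) x
       → LZMWFrom (prev ∷ʳ x) r ps
       → LZMWFrom prev (x ++ r) (x ∷ ps)

data Scheme : Set where
  LZD LZMW : Scheme

IsParsing : {A : Set} → Scheme → List A → List (List A) → Set
IsParsing LZD  s ps = LZDFrom  [] s ps
IsParsing LZMW s ps = LZMWFrom [] s ps

IsMorphism : {A B : Set} → (List A → List B) → Set
IsMorphism φ = ∀ x y → φ (x ++ y) ≡ φ x ++ φ y

-- A coding of an alphabet A is a binary training word t with a uniform morphism φ such that t φ(s)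
-- parses as the parsing of t followed by the images under φ of the phrases of s. From a coding of A
-- and an injection g of a new alphabet C into A × A we get a coding of C with code φ ∘ g, by
-- appending to t the image of a word over A whose phrases are exactly the pairs g(c): for LZD the
-- pairs themselves, ordered so that no pair's second letter begins an earlier pair; for LZMW a walk
-- having these pairs as distinct bigrams, ended by a fresh letter. Afterwards the dictionary holds
-- the codes of all letters of C and nothing else that a code word could extend, so the parsing of
-- φ(g(s)) mirrors that of s. Starting from three letters, i squarings give about 2^(2^i) letters with
-- codes of length 2^(i+1) and training words of length O(letters · code length); any alphabet size k
-- is reached by using only k of the pairs in the last step.

module Submission where

open import Defs
open import Data.Nat using (ℕ; zero; suc; _+_; _*_; _∸_; _^_; _≤_; _<_; z≤n; s≤s; _≤?_)
open import Data.Nat.Properties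
open import Data.Nat.Logarithm using (⌊log₂_⌋; ⌊log₂⌋-mono-≤; ⌊log₂[2^n]⌋≡n)
open import Data.Nat.Solver using (module +-*-Solver)
open import Data.Fin using (Fin; zero; suc; fromℕ)
open import Data.Fin.Properties using () renaming (suc-injective to Fin-suc-injective; 0≢1+n to Fin-0≢1+n)
open import Data.Bool using (Bool; true; false)
open import Data.List using (List; []; _∷_; _++_; _∷ʳ_; [_]; length; map; concatMap; take; lookup; allFin)
open import Data.List.Properties
  using ( ∷-injective; ∷ʳ-injectiveʳ; ∷ʳ-++; ++-assoc; ++-identityʳ; ++-identityʳ-unique; ++-cancelˡ; ++-conicalˡ
        ; map-∘; map-id; map-++; length-++; length-map; length-tabulate; length-take)
open import Data.List.Membership.Propositional using (_∈_; _∉_)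
open import Data.List.Membership.Propositional.Properties
  using (∈-++⁻; ∈-++⁺ˡ; ∈-++⁺ʳ; ∈-map⁺; ∈-map⁻; ∈-lookup)
open import Data.List.Relation.Unary.Any using (here; there)
import Data.List.Relation.Unary.All as All
open import Data.List.Relation.Unary.AllPairs using ([]; _∷_)
open import Data.List.Relation.Unary.Unique.Propositional using (Unique)
open import Data.List.Relation.Unary.Unique.Propositional.Properties using (++⁺; map⁺; allFin⁺; take⁺)
open import Data.Product using (Σ; ∃; ∃₂; _×_; _,_; proj₁; proj₂)
open import Data.Sum using (_⊎_; inj₁; inj₂)
open import Data.Unit using (⊤)
open import Data.Empty using (⊥; ⊥-elim)
open import Function using (_∘_)
open import Relation.Nullary using (¬_; yes; no)
open import Relation.Binary.PropositionalEquality
  using (_≡_; _≢_; refl; sym; trans; cong; cong₂; subst; subst₂; module ≡-Reasoning)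

private variable
  A B C : Set

-- Uniqueness of parsings

prefix-unique : (x x′ w w′ : List A) → x ++ w ≡ x′ ++ w′ → length x ≡ length x′ → x ≡ x′
prefix-unique []      []       _ _ _ _ = refl
prefix-unique (a ∷ x) (b ∷ x′) w w′ e l with ∷-injective e
... | refl , e′ = cong (a ∷_) (prefix-unique x x′ w w′ e′ (suc-injective l))

LongestPrefix-unique : {D : List A → Set} {r x x′ : List A} →
  LongestPrefix D r x → LongestPrefix D r x′ → x ≡ x′
LongestPrefix-unique {x = x} {x′} (dx , (w , e) , max) (dx′ , (w′ , e′) , max′) =
  prefix-unique x x′ w w′ (trans e (sym e′)) (≤-antisym (max′ x dx (w , e)) (max x′ dx′ (w′ , e′)))

LongestPrefix₀-unique : {D : List A → Set} {r x x′ : List A} →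
  LongestPrefix₀ D r x → LongestPrefix₀ D r x′ → x ≡ x′
LongestPrefix₀-unique (inj₁ (_ , refl))      (inj₁ (_ , refl))              = refl
LongestPrefix₀-unique (inj₁ (refl , refl))   (inj₂ (_ , (w , e) , _))       = sym (++-conicalˡ _ w e)
LongestPrefix₀-unique (inj₂ (_ , (w , e) , _)) (inj₁ (refl , refl))         = ++-conicalˡ _ w e
LongestPrefix₀-unique (inj₂ p)               (inj₂ q)                       = LongestPrefix-unique p q

EmptyFree : List (List A) → Set
EmptyFree prev = [] ∉ prev

EmptyFree-∷ʳ : {prev : List (List A)} {x : List A} → EmptyFree prev → x ≢ [] → EmptyFree (prev ∷ʳ x)
EmptyFree-∷ʳ {prev = prev} ef x≢[] m with ∈-++⁻ prev m
... | inj₁ m′        = ef m′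
... | inj₂ (here e) = x≢[] (sym e)

DictLZD-nonempty : {prev : List (List A)} → EmptyFree prev → ¬ DictLZD prev []
DictLZD-nonempty ef (inj₁ m)       = ef m
DictLZD-nonempty ef (inj₂ (_ , ()))

adjPairs-EmptyFree : (prev : List (List A)) → EmptyFree prev → EmptyFree (adjPairs prev)
adjPairs-EmptyFree (p ∷ q ∷ ps) ef (here e)  = ef (here (sym (++-conicalˡ p q (sym e))))
adjPairs-EmptyFree (p ∷ q ∷ ps) ef (there m) = adjPairs-EmptyFree (q ∷ ps) (ef ∘ there) m

DictLZMW-nonempty : {prev : List (List A)} → EmptyFree prev → ¬ DictLZMW prev []
DictLZMW-nonempty {prev = prev} ef = DictLZD-nonempty (adjPairs-EmptyFree prev ef)

LongestPrefix-nonempty : {D : List A → Set} {r x : List A} → ¬ D [] → LongestPrefix D r x → x ≢ []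
LongestPrefix-nonempty ¬D[] (dx , _) refl = ¬D[] dx

LZDFrom-unique : {prev : List (List A)} {r r′ : List A} {ps ps′ : List (List A)} → EmptyFree prev →
  LZDFrom prev r ps → LZDFrom prev r′ ps′ → r ≡ r′ → ps ≡ ps′
LZDFrom-unique ef done done _ = refl
LZDFrom-unique ef done (step x y r ps lx _ _) e =
  ⊥-elim (LongestPrefix-nonempty (DictLZD-nonempty ef) lx (++-conicalˡ x (y ++ r) (sym e)))
LZDFrom-unique ef (step x y r ps lx _ _) done e =
  ⊥-elim (LongestPrefix-nonempty (DictLZD-nonempty ef) lx (++-conicalˡ x (y ++ r) e))
LZDFrom-unique {prev = prev} ef (step x y r ps lx ly rest) (step x′ y′ r′ ps′ lx′ ly′ rest′) e
  with LongestPrefix-unique lx (subst (λ R → LongestPrefix (DictLZD prev) R x′) (sym e) lx′)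
... | refl with ++-cancelˡ x (y ++ r) (y′ ++ r′) e
... | e′ with LongestPrefix₀-unique ly (subst (λ R → LongestPrefix₀ (DictLZD prev) R y′) (sym e′) ly′)
... | refl = cong ((x ++ y) ∷_) (LZDFrom-unique ef″ rest rest′ (++-cancelˡ y r r′ e′))
  where
  ef″ : EmptyFree (prev ∷ʳ (x ++ y))
  ef″ = EmptyFree-∷ʳ ef (LongestPrefix-nonempty (DictLZD-nonempty ef) lx ∘ ++-conicalˡ x y)

LZMWFrom-unique : {prev : List (List A)} {r r′ : List A} {ps ps′ : List (List A)} → EmptyFree prev →
  LZMWFrom prev r ps → LZMWFrom prev r′ ps′ → r ≡ r′ → ps ≡ ps′
LZMWFrom-unique ef done done _ = refl
LZMWFrom-unique ef done (step x r ps lx _) e =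
  ⊥-elim (LongestPrefix-nonempty (DictLZMW-nonempty ef) lx (++-conicalˡ x r (sym e)))
LZMWFrom-unique ef (step x r ps lx _) done e =
  ⊥-elim (LongestPrefix-nonempty (DictLZMW-nonempty ef) lx (++-conicalˡ x r e))
LZMWFrom-unique {prev = prev} ef (step x r ps lx rest) (step x′ r′ ps′ lx′ rest′) e
  with LongestPrefix-unique lx (subst (λ R → LongestPrefix (DictLZMW prev) R x′) (sym e) lx′)
... | refl = cong (x ∷_) (LZMWFrom-unique ef′ rest rest′ (++-cancelˡ x r r′ e))
  where
  ef′ : EmptyFree (prev ∷ʳ x)
  ef′ = EmptyFree-∷ʳ ef (LongestPrefix-nonempty (DictLZMW-nonempty ef) lx)

parsing-unique : (sc : Scheme) {s : List A} {ps ps′ : List (List A)} →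
  IsParsing sc s ps → IsParsing sc s ps′ → ps ≡ ps′
parsing-unique LZD  p q = LZDFrom-unique (λ ()) p q refl
parsing-unique LZMW p q = LZMWFrom-unique (λ ()) p q refl

Prefix-trans : {x y z : List A} → Prefix x y → Prefix y z → Prefix x z
Prefix-trans {x = x} (w , refl) (w′ , refl) = w ++ w′ , sym (++-assoc x w w′)

Prefix-[] : {z : List A} → Prefix z [] → z ≡ []
Prefix-[] {z = z} (w , e) = ++-conicalˡ z w e

map-∷ʳ-shift : (qs : List B) (f : A → B) (xs : List A) (x : A) →
  qs ++ map f (xs ∷ʳ x) ≡ (qs ++ map f xs) ∷ʳ f x
map-∷ʳ-shift qs f xs x = trans (cong (qs ++_) (map-++ f xs [ x ])) (sym (++-assoc qs (map f xs) [ f x ]))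

∈-adjPairs-++⁺ˡ : (xs ys : List (List A)) {z : List A} → z ∈ adjPairs xs → z ∈ adjPairs (xs ++ ys)
∈-adjPairs-++⁺ˡ (a ∷ a′ ∷ xs) ys (here e)  = here e
∈-adjPairs-++⁺ˡ (a ∷ a′ ∷ xs) ys (there m) = there (∈-adjPairs-++⁺ˡ (a′ ∷ xs) ys m)

∈-adjPairs-++⁺ʳ : (xs ys : List (List A)) {z : List A} → z ∈ adjPairs ys → z ∈ adjPairs (xs ++ ys)
∈-adjPairs-++⁺ʳ []            ys       m = m
∈-adjPairs-++⁺ʳ (a ∷ [])      (b ∷ ys) m = there m
∈-adjPairs-++⁺ʳ (a ∷ a′ ∷ xs) ys       m = there (∈-adjPairs-++⁺ʳ (a′ ∷ xs) ys m)

∈-adjPairs-++⁻ : (xs ys : List (List A)) {z : List A} → z ∈ adjPairs (xs ++ ys) →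
  z ∈ adjPairs xs ⊎ z ∈ adjPairs ys ⊎ ∃₂ λ xs′ a → xs ≡ xs′ ∷ʳ a × Prefix a z
∈-adjPairs-++⁻ []            ys       m         = inj₂ (inj₁ m)
∈-adjPairs-++⁻ (a ∷ [])      (b ∷ ys) (here e)  = inj₂ (inj₂ ([] , a , refl , b , sym e))
∈-adjPairs-++⁻ (a ∷ [])      (b ∷ ys) (there m) = inj₂ (inj₁ m)
∈-adjPairs-++⁻ (a ∷ a′ ∷ xs) ys       (here e)  = inj₁ (here e)
∈-adjPairs-++⁻ (a ∷ a′ ∷ xs) ys       (there m) with ∈-adjPairs-++⁻ (a′ ∷ xs) ys m
... | inj₁ m′                            = inj₁ (there m′)
... | inj₂ (inj₁ m′)                     = inj₂ (inj₁ m′)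
... | inj₂ (inj₂ (xs′ , a₀ , e , pre)) = inj₂ (inj₂ (a ∷ xs′ , a₀ , cong (a ∷_) e , pre))

adjPairs-map : {φ : List A → List B} → IsMorphism φ → (ps : List (List A)) →
  adjPairs (map φ ps) ≡ map φ (adjPairs ps)
adjPairs-map φ-++ []           = refl
adjPairs-map φ-++ (p ∷ [])     = refl
adjPairs-map φ-++ (p ∷ q ∷ ps) = cong₂ _∷_ (sym (φ-++ p q)) (adjPairs-map φ-++ (q ∷ ps))

Unique-∷-∉ : (xs : List A) {x : A} {ys : List A} → Unique (xs ++ x ∷ ys) → x ∉ xs
Unique-∷-∉ (_ ∷ xs) (x∉ ∷ _)  (here refl) = All.lookup x∉ (∈-++⁺ʳ xs (here refl)) refl
Unique-∷-∉ (_ ∷ xs) (_ ∷ un) (there m)   = Unique-∷-∉ xs un m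

∷ʳ-≢-[] : (u : List A) (z : A) → u ∷ʳ z ≢ []
∷ʳ-≢-[] []      z ()
∷ʳ-≢-[] (_ ∷ _) z ()

length-take-≤ : (k : ℕ) (xs : List A) → k ≤ length xs → length (take k xs) ≡ k
length-take-≤ k xs k≤ = trans (length-take k xs) (m≤n⇒m⊓n≡m k≤)

pairWord : A × A → List A
pairWord (a , b) = a ∷ b ∷ []

pairWord-Prefix : {p : A × A} {a b : A} {r : List A} → Prefix (pairWord p) (a ∷ b ∷ r) → p ≡ (a , b)
pairWord-Prefix (_ , refl) = refl

length-concatMap-pairWord : (E : List (A × A)) → length (concatMap pairWord E) ≡ 2 * length E
length-concatMap-pairWord []      = refl
length-concatMap-pairWord (p ∷ E) =
  trans (cong (λ n → suc (suc n)) (length-concatMap-pairWord E)) (sym (*-suc 2 (length E)))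

bigrams : List A → List (A × A)
bigrams []           = []
bigrams (a ∷ [])     = []
bigrams (a ∷ b ∷ xs) = (a , b) ∷ bigrams (b ∷ xs)

adjPairs-singletons : (xs : List A) → adjPairs (map [_] xs) ≡ map pairWord (bigrams xs)
adjPairs-singletons []           = refl
adjPairs-singletons (a ∷ [])     = refl
adjPairs-singletons (a ∷ b ∷ xs) = cong ((a ∷ b ∷ []) ∷_) (adjPairs-singletons (b ∷ xs))

∈-adjPairs-singletons-length : (xs : List A) {z : List A} → z ∈ adjPairs (map [_] xs) → length z ≡ 2
∈-adjPairs-singletons-length xs m with ∈-map⁻ pairWord (subst (_ ∈_) (adjPairs-singletons xs) m)
... | _ , _ , refl = refl

∈-bigrams-fst : (xs : List A) {p : A × A} → p ∈ bigrams xs → proj₁ p ∈ xs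
∈-bigrams-fst (a ∷ a′ ∷ xs) (here refl) = here refl
∈-bigrams-fst (a ∷ a′ ∷ xs) (there m)   = there (∈-bigrams-fst (a′ ∷ xs) m)

∈-bigrams-∷ʳ⁻ : (xs : List A) (z : A) {p : A × A} → p ∈ bigrams (xs ∷ʳ z) →
  p ∈ bigrams xs ⊎ (proj₁ p ∈ xs × proj₂ p ≡ z)
∈-bigrams-∷ʳ⁻ (a ∷ [])     z (here refl) = inj₂ (here refl , refl)
∈-bigrams-∷ʳ⁻ (a ∷ b ∷ xs) z (here refl) = inj₁ (here refl)
∈-bigrams-∷ʳ⁻ (a ∷ b ∷ xs) z (there m) with ∈-bigrams-∷ʳ⁻ (b ∷ xs) z m
... | inj₁ m′        = inj₁ (there m′)
... | inj₂ (a∈ , e) = inj₂ (there a∈ , e)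

∈-bigrams-∷ʳ-fst : (xs : List A) (z : A) {p : A × A} → p ∈ bigrams (xs ∷ʳ z) → proj₁ p ∈ xs
∈-bigrams-∷ʳ-fst xs z m with ∈-bigrams-∷ʳ⁻ xs z m
... | inj₁ m′      = ∈-bigrams-fst xs m′
... | inj₂ (a∈ , _) = a∈

length-bigrams-∷ʳ : (xs : List A) (z : A) → length (bigrams (xs ∷ʳ z)) ≡ length xs
length-bigrams-∷ʳ []           z = refl
length-bigrams-∷ʳ (a ∷ [])     z = refl
length-bigrams-∷ʳ (a ∷ b ∷ xs) z = cong suc (length-bigrams-∷ʳ (b ∷ xs) z)

bigrams-map : (f : A → B) (xs : List A) → bigrams (map f xs) ≡ map (λ (a , b) → f a , f b) (bigrams xs)
bigrams-map f []           = refl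
bigrams-map f (a ∷ [])     = refl
bigrams-map f (a ∷ b ∷ xs) = cong ((f a , f b) ∷_) (bigrams-map f (b ∷ xs))

bigrams-++ : (xs ys : List A) → Σ (List (A × A)) λ zs → bigrams (xs ++ ys) ≡ bigrams xs ++ zs
bigrams-++ []            ys       = bigrams ys , refl
bigrams-++ (a ∷ [])      []       = [] , refl
bigrams-++ (a ∷ [])      (b ∷ ys) = bigrams (a ∷ b ∷ ys) , refl
bigrams-++ (a ∷ a′ ∷ xs) ys with bigrams-++ (a′ ∷ xs) ys
... | zs , e = zs , cong ((a , a′) ∷_) e

bigrams-∷ʳ-++ : (xs : List A) (a b : A) (ys : List A) →
  bigrams ((xs ∷ʳ a) ++ b ∷ ys) ≡ bigrams (xs ∷ʳ a) ++ (a , b) ∷ bigrams (b ∷ ys)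
bigrams-∷ʳ-++ []            a b ys = refl
bigrams-∷ʳ-++ (x ∷ [])      a b ys = refl
bigrams-∷ʳ-++ (x ∷ x′ ∷ xs) a b ys = cong ((x , x′) ∷_) (bigrams-∷ʳ-++ (x′ ∷ xs) a b ys)

bigrams-++-last : {W xs : List A} {a b : A} (ys : List A) → W ≡ xs ∷ʳ a →
  bigrams (W ++ b ∷ ys) ≡ bigrams W ++ (a , b) ∷ bigrams (b ∷ ys)
bigrams-++-last {xs = xs} {a} {b} ys refl = bigrams-∷ʳ-++ xs a b ys

bigrams-take : (k : ℕ) (xs : List A) → bigrams (take (suc k) xs) ≡ take k (bigrams xs)
bigrams-take zero    []           = refl
bigrams-take zero    (a ∷ xs)     = refl
bigrams-take (suc k) []           = refl
bigrams-take (suc k) (a ∷ [])     = refl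
bigrams-take (suc k) (a ∷ b ∷ xs) = cong ((a , b) ∷_) (bigrams-take k (b ∷ xs))

Unique-bigrams-∷ʳ : (xs : List A) (z : A) → Unique (bigrams xs) → z ∉ xs → Unique (bigrams (xs ∷ʳ z))
Unique-bigrams-∷ʳ []           z _          _  = []
Unique-bigrams-∷ʳ (a ∷ [])     z _          _  = All.[] ∷ []
Unique-bigrams-∷ʳ (a ∷ b ∷ xs) z (ab∉ ∷ un) z∉ =
  All.tabulate new ∷ Unique-bigrams-∷ʳ (b ∷ xs) z un (z∉ ∘ there)
  where
  new : ∀ {p} → p ∈ bigrams ((b ∷ xs) ∷ʳ z) → (a , b) ≢ p
  new m e with ∈-bigrams-∷ʳ⁻ (b ∷ xs) z m
  ... | inj₁ m′      = All.lookup ab∉ m′ e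
  ... | inj₂ (_ , e′) = z∉ (there (here (sym (trans (cong proj₂ e) e′))))

Unique-bigrams-take : (k : ℕ) (xs : List A) → Unique (bigrams xs) → Unique (bigrams (take k xs))
Unique-bigrams-take zero    xs _  = []
Unique-bigrams-take (suc k) xs un = subst Unique (sym (bigrams-take k xs)) (take⁺ k un)

bigrams-Unique-∉ : (xs : List A) {a b : A} {ys : List A} →
  Unique (bigrams (xs ++ a ∷ b ∷ ys)) → (a , b) ∉ bigrams xs
bigrams-Unique-∉ xs {a} {b} {ys} un m with bigrams-++ xs [ a ]
... | zs , e = Unique-∷-∉ (bigrams (xs ∷ʳ a))
                 (subst Unique (trans (cong bigrams (sym (∷ʳ-++ xs a (b ∷ ys)))) (bigrams-∷ʳ-++ xs a b ys)) un)
                 (subst ((a , b) ∈_) (sym e) (∈-++⁺ˡ m))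

liftPair : {n : ℕ} → Fin n × Fin n → Fin (suc n) × Fin (suc n)
liftPair (x , y) = suc x , suc y

liftPair-injective : {n : ℕ} {p q : Fin n × Fin n} → liftPair p ≡ liftPair q → p ≡ q
liftPair-injective {p = _ , _} {_ , _} refl = refl

lookup-injective : {xs : List A} → Unique xs → {i j : Fin (length xs)} → lookup xs i ≡ lookup xs j → i ≡ j
lookup-injective {xs = _ ∷ _}  _          {zero}  {zero}  _ = refl
lookup-injective {xs = _ ∷ xs} (x∉ ∷ _)  {zero}  {suc j} e = ⊥-elim (All.lookup x∉ (∈-lookup j) e)
lookup-injective {xs = _ ∷ xs} (x∉ ∷ _)  {suc i} {zero}  e = ⊥-elim (All.lookup x∉ (∈-lookup i) (sym e))
lookup-injective {xs = _ ∷ xs} (_ ∷ un) {suc i} {suc j} e = cong suc (lookup-injective un e)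

enumerate : {k : ℕ} (xs : List A) → length xs ≡ k → Fin k → A
enumerate xs refl = lookup xs

enumerate-injective : {k : ℕ} (xs : List A) (e : length xs ≡ k) → Unique xs →
  ∀ {i j} → enumerate xs e i ≡ enumerate xs e j → i ≡ j
enumerate-injective xs refl = lookup-injective

enumerate-∈ : {k : ℕ} (xs : List A) (e : length xs ≡ k) (i : Fin k) → enumerate xs e i ∈ xs
enumerate-∈ xs refl = ∈-lookup

-- Encoding letters by pairs of letters

module PairCode (g : C → A × A) (g-injective : ∀ {c c′} → g c ≡ g c′ → c ≡ c′) where

  encode : List C → List A
  encode = concatMap (pairWord ∘ g)

  encode-++ : IsMorphism encode
  encode-++ []      y = refl
  encode-++ (c ∷ x) y = cong (λ w → proj₁ (g c) ∷ proj₂ (g c) ∷ w) (encode-++ x y)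

  length-encode : (x : List C) → length (encode x) ≡ length x + length x
  length-encode []      = refl
  length-encode (c ∷ x) = cong suc (trans (cong suc (length-encode x)) (sym (+-suc (length x) (length x))))

  encode-mono-length : {x y : List C} → length x ≤ length y → length (encode x) ≤ length (encode y)
  encode-mono-length {x} {y} le rewrite length-encode x | length-encode y = +-mono-≤ le le

  2≤length-encode : {x : List C} → 1 ≤ length x → 2 ≤ length (encode x)
  2≤length-encode {_ ∷ _} _ = s≤s (s≤s z≤n)

  Prefix-encode⁻ : (p q : List C) → Prefix (encode p) (encode q) → Prefix p q
  Prefix-encode⁻ []      q        _       = q , refl
  Prefix-encode⁻ (c ∷ p) (c′ ∷ q) (w , e) with ∷-injective e
  ... | e₁ , e′ with ∷-injective e′
  ... | e₂ , e″ with g-injective (cong₂ _,_ e₁ e₂)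
  ... | refl with Prefix-encode⁻ p q (w , e″)
  ... | v , ev = v , cong (c ∷_) ev

  encode-Prefix : {x r : List C} → Prefix x r → Prefix (encode x) (encode r)
  encode-Prefix {x} (w , e) = encode w , trans (sym (encode-++ x w)) (cong encode e)

  -- Codes of nonempty words have length at least 2, so encoding preserves the maximality of a
  -- longest prefix as long as the new dictionary only adds words of length at most 2.
  encode-LongestPrefix : {D : List C → Set} {D′ : List A → Set} {r x : List C} →
    (∀ c → D [ c ]) →
    (∀ {y} → D y → D′ (encode y)) →
    (∀ {z} → D′ z → Prefix z (encode r) → length z ≤ 2 ⊎ Σ (List C) λ y → z ≡ encode y × D y) →
    LongestPrefix D r x → LongestPrefix D′ (encode r) (encode x)
  encode-LongestPrefix {r = []} _ forward _ (dx , px , _) =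
    forward dx , encode-Prefix px , λ z _ pz → ≤-trans (≤-reflexive (cong length (Prefix-[] pz))) z≤n
  encode-LongestPrefix {D′ = D′} {c ∷ r} {x} letters forward backward (dx , px , max) =
    forward dx , encode-Prefix px , max′
    where
    max′ : ∀ z → D′ z → Prefix z (encode (c ∷ r)) → length z ≤ length (encode x)
    max′ z dz pz with backward dz pz
    ... | inj₁ z≤2             = ≤-trans z≤2 (2≤length-encode {x} (max [ c ] (letters c) (r , refl)))
    ... | inj₂ (y , refl , dy) = encode-mono-length {y} {x} (max y dy (Prefix-encode⁻ y (c ∷ r) pz))

  module _ {qs : List (List A)} (pair∈qs : ∀ c → pairWord (g c) ∈ qs)
           (qs-short : ∀ {z} → z ∈ qs → length z ≤ 2) where

    encode-DictLZD : {prev : List (List C)} {r x : List C} → LongestPrefix (DictLZD prev) r x →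
      LongestPrefix (DictLZD (qs ++ map encode prev)) (encode r) (encode x)
    encode-DictLZD {prev} = encode-LongestPrefix (λ c → inj₂ (c , refl)) forward backward
      where
      forward : ∀ {y} → DictLZD prev y → DictLZD (qs ++ map encode prev) (encode y)
      forward (inj₁ m)          = inj₁ (∈-++⁺ʳ qs (∈-map⁺ encode m))
      forward (inj₂ (c , refl)) = inj₁ (∈-++⁺ˡ (pair∈qs c))
      backward : ∀ {z r} → DictLZD (qs ++ map encode prev) z → Prefix z r →
        length z ≤ 2 ⊎ Σ (List C) λ y → z ≡ encode y × DictLZD prev y
      backward (inj₂ (a , refl)) _ = inj₁ (s≤s z≤n)
      backward (inj₁ m)          _ with ∈-++⁻ qs m
      ... | inj₁ m′ = inj₁ (qs-short m′)
      ... | inj₂ m′ with ∈-map⁻ encode m′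
      ...   | y , y∈ , refl = inj₂ (y , refl , inj₁ y∈)

    encode-DictLZD₀ : {prev : List (List C)} {r y : List C} → LongestPrefix₀ (DictLZD prev) (y ++ r) y →
      LongestPrefix₀ (DictLZD (qs ++ map encode prev)) (encode y ++ encode r) (encode y)
    encode-DictLZD₀ (inj₁ (e , refl)) = inj₁ (cong encode e , refl)
    encode-DictLZD₀ {prev} {r} {y} (inj₂ l) =
      inj₂ (subst (λ R → LongestPrefix _ R (encode y)) (encode-++ y r) (encode-DictLZD l))

    encode-LZDFrom : {prev : List (List C)} {r : List C} {ps : List (List C)} → LZDFrom prev r ps →
      LZDFrom (qs ++ map encode prev) (encode r) (map encode ps)
    encode-LZDFrom done = done
    encode-LZDFrom {prev} (step x y r ps lx ly rest) =
      subst₂ (LZDFrom _) (sym split) (cong (_∷ map encode ps) (sym (encode-++ x y)))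
        (step (encode x) (encode y) (encode r) (map encode ps)
          (subst (λ R → LongestPrefix _ R (encode x)) split (encode-DictLZD lx))
          (encode-DictLZD₀ ly)
          (subst (λ P → LZDFrom P (encode r) (map encode ps)) shift (encode-LZDFrom rest)))
      where
      split : encode (x ++ y ++ r) ≡ encode x ++ encode y ++ encode r
      split = trans (encode-++ x (y ++ r)) (cong (encode x ++_) (encode-++ y r))
      shift : qs ++ map encode (prev ∷ʳ (x ++ y)) ≡ (qs ++ map encode prev) ∷ʳ (encode x ++ encode y)
      shift = trans (map-∷ʳ-shift qs encode prev (x ++ y)) (cong ((qs ++ map encode prev) ∷ʳ_) (encode-++ x y))

  module _ {qs : List (List A)} (pair∈qs : ∀ c → pairWord (g c) ∈ adjPairs qs)
           (adjPairs-short : ∀ {z} r → z ∈ adjPairs qs → Prefix z (encode r) → length z ≤ 2)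
           (last-unmatched : ∀ {qs′ a} r → qs ≡ qs′ ∷ʳ a → ¬ Prefix a (encode r)) where

    encode-DictLZMW : {prev : List (List C)} {r x : List C} → LongestPrefix (DictLZMW prev) r x →
      LongestPrefix (DictLZMW (qs ++ map encode prev)) (encode r) (encode x)
    encode-DictLZMW {prev} {r} = encode-LongestPrefix (λ c → inj₂ (c , refl)) forward backward
      where
      forward : ∀ {y} → DictLZMW prev y → DictLZMW (qs ++ map encode prev) (encode y)
      forward {y} (inj₁ m) = inj₁ (∈-adjPairs-++⁺ʳ qs (map encode prev)
        (subst (encode y ∈_) (sym (adjPairs-map encode-++ prev)) (∈-map⁺ encode m)))
      forward (inj₂ (c , refl)) = inj₁ (∈-adjPairs-++⁺ˡ qs (map encode prev) (pair∈qs c))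
      backward : ∀ {z} → DictLZMW (qs ++ map encode prev) z → Prefix z (encode r) →
        length z ≤ 2 ⊎ Σ (List C) λ y → z ≡ encode y × DictLZMW prev y
      backward (inj₂ (a , refl)) _ = inj₁ (s≤s z≤n)
      backward (inj₁ m) pz with ∈-adjPairs-++⁻ qs (map encode prev) m
      ... | inj₁ m′                       = inj₁ (adjPairs-short r m′ pz)
      ... | inj₂ (inj₂ (_ , _ , e , pa)) = ⊥-elim (last-unmatched r e (Prefix-trans pa pz))
      ... | inj₂ (inj₁ m′) with ∈-map⁻ encode (subst (_ ∈_) (adjPairs-map encode-++ prev) m′)
      ...   | y , y∈ , refl = inj₂ (y , refl , inj₁ y∈)

    encode-LZMWFrom : {prev : List (List C)} {r : List C} {ps : List (List C)} → LZMWFrom prev r ps →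
      LZMWFrom (qs ++ map encode prev) (encode r) (map encode ps)
    encode-LZMWFrom done = done
    encode-LZMWFrom {prev} (step x r ps lx rest) =
      subst (λ R → LZMWFrom _ R _) (sym (encode-++ x r))
        (step (encode x) (encode r) (map encode ps)
          (subst (λ R → LongestPrefix _ R (encode x)) (encode-++ x r) (encode-DictLZMW lx))
          (subst (λ P → LZMWFrom P (encode r) (map encode ps)) (map-∷ʳ-shift qs encode prev x)
            (encode-LZMWFrom rest)))

-- Training words

letter-longest : {prev : List (List A)} {a : A} {r : List A} →
  (∀ {z} → z ∈ prev → Prefix z (a ∷ r) → length z ≤ 1) →
  LongestPrefix (DictLZD prev) (a ∷ r) [ a ]
letter-longest short = inj₂ (_ , refl) , (_ , refl) , λ where
  z (inj₂ (_ , refl)) _  → ≤-refl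
  z (inj₁ m)          pz → short m pz

FreshSeconds : (A → Set) → List (A × A) → Set
FreshSeconds seen []            = ⊤
FreshSeconds seen ((x , y) ∷ E) = ¬ seen y × FreshSeconds (λ a → a ≡ x ⊎ seen a) E

FreshSeconds-antitone : {X Y : A → Set} (E : List (A × A)) → (∀ {a} → X a → Y a) →
  FreshSeconds Y E → FreshSeconds X E
FreshSeconds-antitone []            X⊆Y _              = _
FreshSeconds-antitone ((x , y) ∷ E) X⊆Y (y-unseen , fr) =
  y-unseen ∘ X⊆Y , FreshSeconds-antitone E (λ { (inj₁ e) → inj₁ e ; (inj₂ a) → inj₂ (X⊆Y a) }) fr

FreshSeconds-++ : {X : A → Set} (E₁ E₂ : List (A × A)) → FreshSeconds X E₁ →
  FreshSeconds (λ a → X a ⊎ a ∈ map proj₁ E₁) E₂ → FreshSeconds X (E₁ ++ E₂)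
FreshSeconds-++ []             E₂ _             fr₂ = FreshSeconds-antitone E₂ inj₁ fr₂
FreshSeconds-++ {X = X} ((x , y) ∷ E₁) E₂ (y-unseen , fr₁) fr₂ =
  y-unseen , FreshSeconds-++ E₁ E₂ fr₁ (FreshSeconds-antitone E₂ reassoc fr₂)
  where
  reassoc : ∀ {a} → (a ≡ x ⊎ X a) ⊎ a ∈ map proj₁ E₁ → X a ⊎ a ∈ x ∷ map proj₁ E₁
  reassoc (inj₁ (inj₁ e)) = inj₂ (here e)
  reassoc (inj₁ (inj₂ a)) = inj₁ a
  reassoc (inj₂ m)        = inj₂ (there m)

FreshSeconds-take : {X : A → Set} (k : ℕ) (E : List (A × A)) → FreshSeconds X E → FreshSeconds X (take k E)
FreshSeconds-take zero    E                _             = _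
FreshSeconds-take (suc k) []               _             = _
FreshSeconds-take (suc k) ((x , y) ∷ E) (y-unseen , fr) = y-unseen , FreshSeconds-take k E fr

-- Each pair becomes a phrase: its first letter cannot be extended because the pair is new, its
-- second letter cannot be extended because no earlier pair starts with it.
train-LZDFrom : (E₁ E₂ : List (A × A)) (seen : A → Set) →
  (∀ {p} → p ∈ E₁ → seen (proj₁ p)) → FreshSeconds seen E₂ → Unique (E₁ ++ E₂) →
  {w : List A} {rest : List (List A)} → LZDFrom (map pairWord (E₁ ++ E₂)) w rest →
  LZDFrom (map pairWord E₁) (concatMap pairWord E₂ ++ w) (map pairWord E₂ ++ rest)
train-LZDFrom E₁ [] _ _ _ _ {w} {rest} d = subst (λ E → LZDFrom (map pairWord E) w rest) (++-identityʳ E₁) d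
train-LZDFrom E₁ ((x , y) ∷ E₂) seen seen-E₁ (y-unseen , fresh) unique {w} {rest} d =
  step [ x ] [ y ] (concatMap pairWord E₂ ++ w) (map pairWord E₂ ++ rest)
    (letter-longest first-short) (inj₂ (letter-longest second-short))
    (subst (λ P → LZDFrom P (concatMap pairWord E₂ ++ w) (map pairWord E₂ ++ rest)) (map-++ pairWord E₁ [ x , y ])
      (train-LZDFrom (E₁ ∷ʳ (x , y)) E₂ (λ a → a ≡ x ⊎ seen a) seen-E₁′ fresh
        (subst Unique (sym assoc) unique) (subst (λ E → LZDFrom (map pairWord E) w rest) (sym assoc) d)))
  where
  assoc : (E₁ ∷ʳ (x , y)) ++ E₂ ≡ E₁ ++ (x , y) ∷ E₂
  assoc = ++-assoc E₁ [ x , y ] E₂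
  first-short : ∀ {z} → z ∈ map pairWord E₁ → Prefix z (x ∷ y ∷ concatMap pairWord E₂ ++ w) → length z ≤ 1
  first-short m pz with ∈-map⁻ pairWord m
  ... | q , q∈ , refl = ⊥-elim (Unique-∷-∉ E₁ unique (subst (_∈ E₁) (pairWord-Prefix pz) q∈))
  second-short : ∀ {z} → z ∈ map pairWord E₁ → Prefix z (y ∷ concatMap pairWord E₂ ++ w) → length z ≤ 1
  second-short m (_ , e) with ∈-map⁻ pairWord m
  ... | q , q∈ , refl = ⊥-elim (y-unseen (subst seen (proj₁ (∷-injective e)) (seen-E₁ q∈)))
  seen-E₁′ : ∀ {p} → p ∈ E₁ ∷ʳ (x , y) → proj₁ p ≡ x ⊎ seen (proj₁ p)
  seen-E₁′ m with ∈-++⁻ E₁ m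
  ... | inj₁ m′          = inj₂ (seen-E₁ m′)
  ... | inj₂ (here refl) = inj₁ refl

walk-letter-short : (pre : List A) (a : A) (ys : List A) → ys ≢ [] → Unique (bigrams (pre ++ a ∷ ys)) →
  ∀ {y} w → y ∈ adjPairs (map [_] pre) → Prefix y (a ∷ ys ++ w) → length y ≤ 1
walk-letter-short pre a []       ys≢[] = ⊥-elim (ys≢[] refl)
walk-letter-short pre a (b ∷ ys) _ un w m pz with ∈-map⁻ pairWord (subst (_ ∈_) (adjPairs-singletons pre) m)
... | q , q∈ , refl = ⊥-elim (bigrams-Unique-∉ pre un (subst (_∈ bigrams pre) (pairWord-Prefix pz) q∈))

-- A letter cannot be extended since the bigram it starts is new, and the final letter z starts no
-- bigram at all.
train-LZMWFrom : (pre u : List A) (z : A) → Unique (bigrams (pre ++ (u ∷ʳ z))) → z ∉ pre ++ u →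
  {w : List A} {rest : List (List A)} → LZMWFrom (map [_] (pre ++ (u ∷ʳ z))) w rest →
  LZMWFrom (map [_] pre) ((u ∷ʳ z) ++ w) (map [_] (u ∷ʳ z) ++ rest)
train-LZMWFrom pre [] z un z∉ {w} {rest} d =
  step [ z ] w rest (letter-longest short) (subst (λ P → LZMWFrom P w rest) (map-++ [_] pre [ z ]) d)
  where
  short : ∀ {y} → y ∈ adjPairs (map [_] pre) → Prefix y (z ∷ w) → length y ≤ 1
  short m (_ , e) with ∈-map⁻ pairWord (subst (_ ∈_) (adjPairs-singletons pre) m)
  ... | q , q∈ , refl = ⊥-elim (z∉ (∈-++⁺ˡ (subst (_∈ pre) (proj₁ (∷-injective e)) (∈-bigrams-fst pre q∈))))
train-LZMWFrom pre (a ∷ u) z un z∉ {w} {rest} d =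
  step [ a ] ((u ∷ʳ z) ++ w) (map [_] (u ∷ʳ z) ++ rest)
    (letter-longest (walk-letter-short pre a (u ∷ʳ z) (∷ʳ-≢-[] u z) un w))
    (subst (λ P → LZMWFrom P ((u ∷ʳ z) ++ w) (map [_] (u ∷ʳ z) ++ rest)) (map-++ [_] pre [ a ])
      (train-LZMWFrom (pre ∷ʳ a) u z (subst (Unique ∘ bigrams) (sym assoc) un)
        (subst (z ∉_) (sym (++-assoc pre [ a ] u)) z∉)
        (subst (λ P → LZMWFrom (map [_] P) w rest) (sym assoc) d)))
  where
  assoc : (pre ∷ʳ a) ++ (u ∷ʳ z) ≡ pre ++ a ∷ (u ∷ʳ z)
  assoc = ++-assoc pre [ a ] (u ∷ʳ z)

-- Codings

Simulates : {A B : Set} → Scheme → List B → List (List B) → (List A → List B) → Set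
Simulates sc t qs φ = ∀ s ps → IsParsing sc s ps → IsParsing sc (t ++ φ s) (qs ++ map φ ps)

IsMorphism-[] : (φ : List A → List B) → IsMorphism φ → φ [] ≡ []
IsMorphism-[] φ φ-++ = ++-identityʳ-unique (φ []) (φ-++ [] [])

length-morphism : (φ : List A → List B) {ℓ : ℕ} → IsMorphism φ → (∀ a → length (φ [ a ]) ≡ ℓ) →
  (s : List A) → length (φ s) ≡ length s * ℓ
length-morphism φ φ-++ φ-letter []      = cong length (IsMorphism-[] φ φ-++)
length-morphism φ {ℓ} φ-++ φ-letter (a ∷ s) = begin
  length (φ ([ a ] ++ s))          ≡⟨ cong length (φ-++ [ a ] s) ⟩
  length (φ [ a ] ++ φ s)          ≡⟨ length-++ (φ [ a ]) ⟩
  length (φ [ a ]) + length (φ s)  ≡⟨ cong₂ _+_ (φ-letter a) (length-morphism φ φ-++ φ-letter s) ⟩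
  ℓ + length s * ℓ                 ∎
  where open ≡-Reasoning

emptyParsing : (sc : Scheme) → IsParsing {A} sc [] []
emptyParsing LZD  = done
emptyParsing LZMW = done

Simulates-parsing : {sc : Scheme} {t : List B} {qs : List (List B)} {φ : List A → List B} →
  IsMorphism φ → Simulates sc t qs φ → IsParsing sc t qs
Simulates-parsing {sc = sc} {t} {qs} {φ} φ-++ sim =
  subst₂ (IsParsing sc) (trans (cong (t ++_) (IsMorphism-[] φ φ-++)) (++-identityʳ t)) (++-identityʳ qs)
    (sim [] [] (emptyParsing sc))

Simulates-∘ : {sc : Scheme} {t : List B} {qs : List (List B)} {φ : List A → List B}
  {u : List A} {us : List (List A)} {ψ : List C → List A} → IsMorphism φ →
  Simulates sc t qs φ → Simulates sc u us ψ → Simulates sc (t ++ φ u) (qs ++ map φ us) (φ ∘ ψ)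
Simulates-∘ {sc = sc} {t} {qs} {φ} {u} {us} {ψ} φ-++ simφ simψ s ps d =
  subst₂ (IsParsing sc) word phrases (simφ (u ++ ψ s) (us ++ map ψ ps) (simψ s ps d))
  where
  open ≡-Reasoning
  word : t ++ φ (u ++ ψ s) ≡ (t ++ φ u) ++ φ (ψ s)
  word = trans (cong (t ++_) (φ-++ u (ψ s))) (sym (++-assoc t (φ u) (φ (ψ s))))
  phrases : qs ++ map φ (us ++ map ψ ps) ≡ (qs ++ map φ us) ++ map (φ ∘ ψ) ps
  phrases = begin
    qs ++ map φ (us ++ map ψ ps)        ≡⟨ cong (qs ++_) (map-++ φ us (map ψ ps)) ⟩
    qs ++ map φ us ++ map φ (map ψ ps)  ≡⟨ sym (++-assoc qs (map φ us) _) ⟩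
    (qs ++ map φ us) ++ map φ (map ψ ps) ≡⟨ cong ((qs ++ map φ us) ++_) (sym (map-∘ ps)) ⟩
    (qs ++ map φ us) ++ map (φ ∘ ψ) ps  ∎

record Coding (sc : Scheme) (A : Set) : Set where
  field
    training    : List Bool
    phrases     : List (List Bool)
    code        : List A → List Bool
    codeLength  : ℕ
    code-++     : IsMorphism code
    code-letter : ∀ a → length (code [ a ]) ≡ codeLength
    simulates   : Simulates sc training phrases code

open Coding

length-code : {sc : Scheme} (L : Coding sc A) (s : List A) → length (code L s) ≡ length s * codeLength L
length-code L = length-morphism (code L) (code-++ L) (code-letter L)

length-training-++ : {sc : Scheme} (L : Coding sc A) (u : List A) →
  length (training L ++ code L u) ≡ length (training L) + length u * codeLength L
length-training-++ L u = trans (length-++ (training L)) (cong (length (training L) +_) (length-code L u))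

Coding-parses : {sc : Scheme} (L : Coding sc A) (s : List A) (ps : List (List A)) (qs : List (List Bool)) →
  IsParsing sc s ps → IsParsing sc (training L) qs → IsParsing sc (training L ++ code L s) (qs ++ map (code L) ps)
Coding-parses {sc = sc} L s ps qs dps dqs =
  subst (λ Q → IsParsing sc (training L ++ code L s) (Q ++ map (code L) ps))
    (parsing-unique sc (Simulates-parsing (code-++ L) (simulates L)) dqs) (simulates L s ps dps)

identityCoding : (sc : Scheme) → Coding sc Bool
identityCoding sc = record
  { training = [] ; phrases = [] ; code = λ s → s ; codeLength = 1
  ; code-++ = λ _ _ → refl ; code-letter = λ _ → refl
  ; simulates = λ s ps d → subst (IsParsing sc s) (sym (map-id ps)) d }

refine : {sc : Scheme} (L : Coding sc A) (g : C → A × A) (g-injective : ∀ {c c′} → g c ≡ g c′ → c ≡ c′)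
  (u : List A) (us : List (List A)) → Simulates sc u us (PairCode.encode g g-injective) → Coding sc C
refine L g g-injective u us sim = record
  { training    = training L ++ code L u
  ; phrases     = phrases L ++ map (code L) us
  ; code        = code L ∘ encode
  ; codeLength  = 2 * codeLength L
  ; code-++     = λ x y → trans (cong (code L) (encode-++ x y)) (code-++ L (encode x) (encode y))
  ; code-letter = λ c → length-code L (pairWord (g c))
  ; simulates   = Simulates-∘ (code-++ L) (simulates L) sim }
  where open PairCode g g-injective

refineLZD : {k : ℕ} → Coding LZD A → (E : List (A × A)) → FreshSeconds (λ _ → ⊥) E → Unique E →
  length E ≡ k → Coding LZD (Fin k)
refineLZD L E fresh un e = refine L g g-injective (concatMap pairWord E) (map pairWord E) sim
  where
  g = enumerate E e
  g-injective = enumerate-injective E e un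
  open PairCode g g-injective
  short : ∀ {z} → z ∈ map pairWord E → length z ≤ 2
  short m with ∈-map⁻ pairWord m
  ... | _ , _ , refl = ≤-refl
  sim : Simulates LZD (concatMap pairWord E) (map pairWord E) encode
  sim s ps d = train-LZDFrom [] E (λ _ → ⊥) (λ ()) fresh un
    (subst (λ P → LZDFrom P (encode s) (map encode ps)) (++-identityʳ _)
      (encode-LZDFrom (λ c → ∈-map⁺ pairWord (enumerate-∈ E e c)) short d))

length-training-refineLZD : {k : ℕ} (L : Coding LZD A) (E : List (A × A)) (fr : FreshSeconds (λ _ → ⊥) E)
  (un : Unique E) (e : length E ≡ k) →
  length (training (refineLZD L E fr un e)) ≡ length (training L) + 2 * k * codeLength L
length-training-refineLZD L E fr un e =
  trans (length-training-++ L (concatMap pairWord E))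
    (cong (λ n → length (training L) + n * codeLength L) (trans (length-concatMap-pairWord E) (cong (2 *_) e)))

refineLZMW : {k : ℕ} → Coding LZMW A → (ws : List A) (z : A) → Unique (bigrams ws) → z ∉ ws →
  length (bigrams (ws ∷ʳ z)) ≡ k → Coding LZMW (Fin k)
refineLZMW L ws z un z∉ e = refine L g g-injective (ws ∷ʳ z) (map [_] (ws ∷ʳ z)) sim
  where
  un′ = Unique-bigrams-∷ʳ ws z un z∉
  g = enumerate (bigrams (ws ∷ʳ z)) e
  g-injective = enumerate-injective (bigrams (ws ∷ʳ z)) e un′
  open PairCode g g-injective
  pair∈ : ∀ c → pairWord (g c) ∈ adjPairs (map [_] (ws ∷ʳ z))
  pair∈ c = subst (pairWord (g c) ∈_) (sym (adjPairs-singletons (ws ∷ʳ z))) (∈-map⁺ pairWord (enumerate-∈ _ e c))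
  short : ∀ {y} r → y ∈ adjPairs (map [_] (ws ∷ʳ z)) → Prefix y (encode r) → length y ≤ 2
  short r m _ = ≤-reflexive (∈-adjPairs-singletons-length (ws ∷ʳ z) m)
  -- The last training phrase is [ z ], and no code starts with z.
  unmatched : ∀ {qs′ a} r → map [_] (ws ∷ʳ z) ≡ qs′ ∷ʳ a → ¬ Prefix a (encode r)
  unmatched r e′ pa with ∷ʳ-injectiveʳ (map [_] ws) _ (trans (sym (map-++ [_] ws [ z ])) e′)
  unmatched []      _ (_ , ()) | refl
  unmatched (c ∷ r) _ (_ , e″) | refl =
    z∉ (subst (_∈ ws) (sym (proj₁ (∷-injective e″))) (∈-bigrams-∷ʳ-fst ws z (enumerate-∈ _ e c)))
  sim : Simulates LZMW (ws ∷ʳ z) (map [_] (ws ∷ʳ z)) encode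
  sim s ps d = train-LZMWFrom [] ws z un′ z∉
    (subst (λ P → LZMWFrom P (encode s) (map encode ps)) (++-identityʳ _) (encode-LZMWFrom pair∈ short unmatched d))

-- Lifting the walk into Fin (suc m) frees the letter zero to end the training word.
refineLZMW-lifted : {m k : ℕ} → Coding LZMW (Fin (suc m)) → (w : List (Fin m)) → Unique (bigrams w) →
  length w ≡ k → Coding LZMW (Fin k)
refineLZMW-lifted L w un e = refineLZMW L (map suc w) zero
  (subst Unique (sym (bigrams-map suc w)) (map⁺ liftPair-injective un)) zero∉
  (trans (length-bigrams-∷ʳ (map suc w) zero) (trans (length-map suc w) e))
  where
  zero∉ : zero ∉ map suc w
  zero∉ m with ∈-map⁻ suc m
  ... | _ , _ , ()

length-training-refineLZMW-lifted : {m k : ℕ} (L : Coding LZMW (Fin (suc m))) (w : List (Fin m))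
  (un : Unique (bigrams w)) (e : length w ≡ k) →
  length (training (refineLZMW-lifted L w un e)) ≡ length (training L) + suc k * codeLength L
length-training-refineLZMW-lifted L w un e =
  trans (length-training-++ L (map suc w ∷ʳ zero))
    (cong (λ n → length (training L) + n * codeLength L)
      (trans (length-++ (map suc w)) (trans (+-comm _ 1) (cong suc (trans (length-map suc w) e)))))

-- Pair enumerations and walks

FreshSeconds-liftPair : {n : ℕ} {Y : Fin n → Set} (E : List (Fin n × Fin n)) → FreshSeconds Y E →
  FreshSeconds (λ a → a ≡ zero ⊎ ∃ λ b → a ≡ suc b × Y b) (map liftPair E)
FreshSeconds-liftPair []            _               = _
FreshSeconds-liftPair {Y = Y} ((x , y) ∷ E) (y-unseen , fr) =
  unseen , FreshSeconds-antitone (map liftPair E) shift (FreshSeconds-liftPair E fr)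
  where
  unseen : ¬ (suc y ≡ zero ⊎ ∃ λ b → suc y ≡ suc b × Y b)
  unseen (inj₂ (b , refl , yb)) = y-unseen yb
  shift : ∀ {a} → a ≡ suc x ⊎ (a ≡ zero ⊎ ∃ λ b → a ≡ suc b × Y b) →
    a ≡ zero ⊎ ∃ λ b → a ≡ suc b × (b ≡ x ⊎ Y b)
  shift (inj₁ e)                     = inj₂ (x , e , inj₁ refl)
  shift (inj₂ (inj₁ e))              = inj₁ e
  shift (inj₂ (inj₂ (b , e , yb))) = inj₂ (b , e , inj₂ yb)

zeroPair : {n : ℕ} → Fin n → Fin (suc n) × Fin (suc n)
zeroPair i = zero , suc i

firstRow : (n : ℕ) → List (Fin (suc n) × Fin (suc n))
firstRow n = (zero , zero) ∷ map zeroPair (allFin n)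

-- The pairs (i , j) with i ≤ j, in lexicographic order.
lexPairs : (n : ℕ) → List (Fin n × Fin n)
lexPairs zero    = []
lexPairs (suc n) = firstRow n ++ map liftPair (lexPairs n)

length-lexPairs-suc : (n : ℕ) → length (lexPairs (suc n)) ≡ suc n + length (lexPairs n)
length-lexPairs-suc n =
  trans (length-++ (firstRow n))
    (cong₂ _+_ (cong suc (trans (length-map _ (allFin n)) (length-tabulate (λ i → i)))) (length-map liftPair (lexPairs n)))

length-lexPairs≤ : (n : ℕ) → length (lexPairs n) ≤ n * n
length-lexPairs≤ zero    = z≤n
length-lexPairs≤ (suc n) = begin
  length (lexPairs (suc n)) ≡⟨ length-lexPairs-suc n ⟩
  suc n + length (lexPairs n) ≤⟨ +-monoʳ-≤ (suc n) (≤-trans (length-lexPairs≤ n) (*-monoʳ-≤ n (n≤1+n n))) ⟩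
  suc n + n * suc n ∎
  where open ≤-Reasoning

square≤4*length-lexPairs : (n : ℕ) → n * n ≤ 4 * length (lexPairs n)
square≤4*length-lexPairs zero    = z≤n
square≤4*length-lexPairs (suc n) = begin
  suc n * suc n                        ≡⟨ square-suc ⟩
  suc (n + n) + n * n                  ≤⟨ +-mono-≤ 2n+1≤4n+4 (square≤4*length-lexPairs n) ⟩
  4 * suc n + 4 * length (lexPairs n)  ≡⟨ sym (*-distribˡ-+ 4 (suc n) (length (lexPairs n))) ⟩
  4 * (suc n + length (lexPairs n))    ≡⟨ cong (4 *_) (sym (length-lexPairs-suc n)) ⟩
  4 * length (lexPairs (suc n))        ∎
  where
  open ≤-Reasoning
  open +-*-Solver
  square-suc : suc n * suc n ≡ suc (n + n) + n * n
  square-suc = solve 1 (λ n → (con 1 :+ n) :* (con 1 :+ n) := (con 1 :+ (n :+ n)) :+ n :* n) refl n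
  2n+1≤4n+4 : suc (n + n) ≤ 4 * suc n
  2n+1≤4n+4 = ≤-trans (s≤s (+-monoʳ-≤ n (n≤1+n n))) (+-monoʳ-≤ (suc n) (m≤m+n (suc n) _))

n≤length-lexPairs : (n : ℕ) → n ≤ length (lexPairs n)
n≤length-lexPairs zero    = z≤n
n≤length-lexPairs (suc n) = subst (suc n ≤_) (sym (length-lexPairs-suc n)) (m≤m+n (suc n) _)

∈-firstRow-fst : (n : ℕ) {p : Fin (suc n) × Fin (suc n)} → p ∈ firstRow n → proj₁ p ≡ zero
∈-firstRow-fst n (here refl) = refl
∈-firstRow-fst n (there m) with ∈-map⁻ _ m
... | _ , _ , refl = refl

firstRow-Unique : (n : ℕ) → Unique (firstRow n)
firstRow-Unique n = All.tabulate zero∉ ∷ map⁺ (λ e → Fin-suc-injective (cong proj₂ e)) (allFin⁺ n)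
  where
  zero∉ : ∀ {q : Fin (suc n) × Fin (suc n)} → q ∈ map zeroPair (allFin n) → (zero , zero) ≢ q
  zero∉ m with ∈-map⁻ zeroPair m
  ... | _ , _ , refl = Fin-0≢1+n ∘ cong proj₂

lexPairs-Unique : (n : ℕ) → Unique (lexPairs n)
lexPairs-Unique zero    = []
lexPairs-Unique (suc n) = ++⁺ (firstRow-Unique n) (map⁺ liftPair-injective (lexPairs-Unique n)) disjoint
  where
  disjoint : ∀ {p} → ¬ (p ∈ firstRow n × p ∈ map liftPair (lexPairs n))
  disjoint (m₁ , m₂) with ∈-map⁻ liftPair m₂
  ... | _ , _ , refl with ∈-firstRow-fst n m₁
  ... | ()

FreshSeconds-row : {n : ℕ} {X : Fin (suc n) → Set} (L : List (Fin n)) → (∀ {a} → X a → a ≡ zero) →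
  FreshSeconds X (map zeroPair L)
FreshSeconds-row []      X⊆0 = _
FreshSeconds-row (i ∷ L) X⊆0 =
  (λ x → Fin-0≢1+n (sym (X⊆0 x))) , FreshSeconds-row L (λ { (inj₁ e) → e ; (inj₂ x) → X⊆0 x })

lexPairs-FreshSeconds : (n : ℕ) → FreshSeconds (λ _ → ⊥) (lexPairs n)
lexPairs-FreshSeconds zero    = _
lexPairs-FreshSeconds (suc n) =
  FreshSeconds-++ (firstRow n) (map liftPair (lexPairs n))
    ((λ ()) , FreshSeconds-row (allFin n) (λ { (inj₁ e) → e ; (inj₂ ()) }))
    (FreshSeconds-antitone (map liftPair (lexPairs n)) seen-zero
      (FreshSeconds-liftPair (lexPairs n) (lexPairs-FreshSeconds n)))
  where
  seen-zero : ∀ {a} → ⊥ ⊎ a ∈ map proj₁ (firstRow n) → a ≡ zero ⊎ ∃ λ b → a ≡ suc b × ⊥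
  seen-zero (inj₂ m) with ∈-map⁻ proj₁ m
  ... | p , p∈ , refl = inj₁ (∈-firstRow-fst n p∈)

ascending : (n : ℕ) → List (Fin n)
ascending zero    = []
ascending (suc n) = zero ∷ map suc (ascending n)

length-ascending : (n : ℕ) → length (ascending n) ≡ n
length-ascending zero    = refl
length-ascending (suc n) = cong suc (trans (length-map suc (ascending n)) (length-ascending n))

ascending-Unique : (n : ℕ) → Unique (ascending n)
ascending-Unique zero    = []
ascending-Unique (suc n) = All.tabulate zero∉ ∷ map⁺ Fin-suc-injective (ascending-Unique n)
  where
  zero∉ : ∀ {i} → i ∈ map suc (ascending n) → zero ≢ i
  zero∉ m with ∈-map⁻ suc m
  ... | _ , _ , refl = Fin-0≢1+n

ascending-last : (n : ℕ) → ∃ λ ys → ascending (suc n) ≡ ys ∷ʳ fromℕ n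
ascending-last zero    = [] , refl
ascending-last (suc n) with ascending-last n
... | ys , e = zero ∷ map suc ys , cong (zero ∷_) (trans (cong (map suc) e) (map-++ suc ys [ fromℕ n ]))

zigzag : {n : ℕ} → List (Fin n) → List (Fin (suc n))
zigzag []      = []
zigzag (i ∷ L) = zero ∷ suc i ∷ zigzag L

length-zigzag : {n : ℕ} (L : List (Fin n)) → length (zigzag L) ≡ length L + length L
length-zigzag []      = refl
length-zigzag (i ∷ L) = cong suc (trans (cong suc (length-zigzag L)) (sym (+-suc (length L) (length L))))

zigzag-∷ʳ : {n : ℕ} (L : List (Fin n)) (l : Fin n) → zigzag (L ∷ʳ l) ≡ (zigzag L ∷ʳ zero) ∷ʳ suc l
zigzag-∷ʳ []      l = refl
zigzag-∷ʳ (i ∷ L) l = cong (λ R → zero ∷ suc i ∷ R) (zigzag-∷ʳ L l)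

∈-bigrams-zigzag⁻ : {n : ℕ} (L : List (Fin n)) {p : Fin (suc n) × Fin (suc n)} → p ∈ bigrams (zigzag L) →
  (∃ λ i → i ∈ L × p ≡ (zero , suc i)) ⊎ (∃₂ λ i j → (i , j) ∈ bigrams L × p ≡ (suc i , zero))
∈-bigrams-zigzag⁻ (i ∷ [])     (here refl)         = inj₁ (i , here refl , refl)
∈-bigrams-zigzag⁻ (i ∷ j ∷ L) (here refl)         = inj₁ (i , here refl , refl)
∈-bigrams-zigzag⁻ (i ∷ j ∷ L) (there (here refl)) = inj₂ (i , j , here refl , refl)
∈-bigrams-zigzag⁻ (i ∷ j ∷ L) (there (there m)) with ∈-bigrams-zigzag⁻ (j ∷ L) m
... | inj₁ (k , k∈ , e)      = inj₁ (k , there k∈ , e)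
... | inj₂ (k , l , kl∈ , e) = inj₂ (k , l , there kl∈ , e)

zigzag-bigrams-Unique : {n : ℕ} (L : List (Fin n)) → Unique L → Unique (bigrams (zigzag L))
zigzag-bigrams-Unique []           _          = []
zigzag-bigrams-Unique (i ∷ [])     _          = All.[] ∷ []
zigzag-bigrams-Unique (i ∷ j ∷ L) (i∉ ∷ un) =
  All.tabulate out-new ∷ All.tabulate in-new ∷ zigzag-bigrams-Unique (j ∷ L) un
  where
  out-new : ∀ {p} → p ∈ (suc i , zero) ∷ bigrams (zigzag (j ∷ L)) → (zero , suc i) ≢ p
  out-new (here refl) ()
  out-new (there m) e with ∈-bigrams-zigzag⁻ (j ∷ L) m
  out-new (there m) refl | inj₁ (k , k∈ , refl) = All.lookup i∉ k∈ refl
  out-new (there m) refl | inj₂ (_ , _ , _ , ())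
  in-new : ∀ {p} → p ∈ bigrams (zigzag (j ∷ L)) → (suc i , zero) ≢ p
  in-new m e with ∈-bigrams-zigzag⁻ (j ∷ L) m
  in-new m refl | inj₁ (_ , _ , ())
  in-new m refl | inj₂ (k , _ , kl∈ , refl) = All.lookup i∉ (∈-bigrams-fst (j ∷ L) kl∈) refl

HasZero : {n : ℕ} → Fin (suc n) × Fin (suc n) → Set
HasZero (a , b) = a ≡ zero ⊎ b ≡ zero

∈-bigrams-zigzag-HasZero : {n : ℕ} (L : List (Fin n)) {p : Fin (suc n) × Fin (suc n)} →
  p ∈ bigrams (zigzag L) → HasZero p
∈-bigrams-zigzag-HasZero L m with ∈-bigrams-zigzag⁻ L m
... | inj₁ (_ , _ , refl)     = inj₁ refl
... | inj₂ (_ , _ , _ , refl) = inj₂ refl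

-- A walk through n² distinct edges of the complete digraph with loops on Fin n: the walk on the
-- letters above zero, then the loop at zero and a zigzag through zero.
walk : (n : ℕ) → List (Fin n)
walk zero    = []
walk (suc n) = map suc (walk n) ++ zero ∷ zigzag (ascending n)

length-walk : (n : ℕ) → length (walk n) ≡ n * n
length-walk zero    = refl
length-walk (suc n) = begin
  length (map suc (walk n) ++ zero ∷ zigzag (ascending n))
    ≡⟨ length-++ (map suc (walk n)) ⟩
  length (map suc (walk n)) + suc (length (zigzag (ascending n)))
    ≡⟨ cong₂ (λ a b → a + suc b) (trans (length-map suc (walk n)) (length-walk n))
             (trans (length-zigzag (ascending n)) (cong₂ _+_ (length-ascending n) (length-ascending n))) ⟩
  n * n + suc (n + n)
    ≡⟨ solve 1 (λ n → n :* n :+ (con 1 :+ (n :+ n)) := (con 1 :+ n) :* (con 1 :+ n)) refl n ⟩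
  suc n * suc n ∎
  where
  open ≡-Reasoning
  open +-*-Solver

walk-last : (n : ℕ) → ∃ λ xs → walk (suc n) ≡ xs ∷ʳ fromℕ n
walk-last zero    = [] , refl
walk-last (suc n) with ascending-last n
... | ys , e = map suc (walk (suc n)) ++ zero ∷ (zigzag ys ∷ʳ zero) ,
  trans (cong (λ R → map suc (walk (suc n)) ++ zero ∷ R) (trans (cong zigzag e) (zigzag-∷ʳ ys (fromℕ n))))
        (sym (++-assoc (map suc (walk (suc n))) (zero ∷ (zigzag ys ∷ʳ zero)) [ suc (fromℕ n) ]))

-- New edges all pass through zero, old ones are lifted away from it; the edge into zero that closes
-- the old walk is the one the zigzag leaves out.
walk-bigrams-Unique-suc : (n : ℕ) → Unique (bigrams (walk (suc n))) → Unique (bigrams (walk (suc (suc n))))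
walk-bigrams-Unique-suc n un with walk-last n | ascending-last n
... | xs , eW | ys , eA = subst Unique (sym split) (++⁺ (map⁺ liftPair-injective un) new-Unique disjoint)
  where
  R = zigzag (ascending (suc n))
  l = fromℕ n
  split : bigrams (walk (suc (suc n))) ≡ map liftPair (bigrams (walk (suc n))) ++ (suc l , zero) ∷ bigrams (zero ∷ R)
  split = trans (bigrams-++-last R (trans (cong (map suc) eW) (map-++ suc xs [ l ])))
                (cong (_++ (suc l , zero) ∷ bigrams (zero ∷ R)) (bigrams-map suc (walk (suc n))))
  l∉ys : l ∉ ys
  l∉ys = Unique-∷-∉ ys (subst Unique eA (ascending-Unique (suc n)))
  closing-new : ∀ {p} → p ∈ (zero , zero) ∷ bigrams R → (suc l , zero) ≢ p
  closing-new (here refl) ()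
  closing-new (there m) e with ∈-bigrams-zigzag⁻ (ascending (suc n)) m
  closing-new (there m) refl | inj₁ (_ , _ , ())
  closing-new (there m) refl | inj₂ (i , j , ij∈ , refl) =
    l∉ys (∈-bigrams-∷ʳ-fst ys l (subst (λ L → (l , j) ∈ bigrams L) eA ij∈))
  loop-new : ∀ {p} → p ∈ bigrams R → (zero , zero) ≢ p
  loop-new m e with ∈-bigrams-zigzag⁻ (ascending (suc n)) m
  loop-new m refl | inj₁ (_ , _ , ())
  loop-new m refl | inj₂ (_ , _ , _ , ())
  new-Unique : Unique ((suc l , zero) ∷ (zero , zero) ∷ bigrams R)
  new-Unique = All.tabulate closing-new ∷ All.tabulate loop-new ∷ zigzag-bigrams-Unique _ (ascending-Unique (suc n))
  new-HasZero : ∀ {p} → p ∈ (suc l , zero) ∷ (zero , zero) ∷ bigrams R → HasZero p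
  new-HasZero (here refl)         = inj₂ refl
  new-HasZero (there (here refl)) = inj₁ refl
  new-HasZero (there (there m))   = ∈-bigrams-zigzag-HasZero (ascending (suc n)) m
  disjoint : ∀ {p} → ¬ (p ∈ map liftPair (bigrams (walk (suc n))) × p ∈ (suc l , zero) ∷ (zero , zero) ∷ bigrams R)
  disjoint (m₁ , m₂) with ∈-map⁻ liftPair m₁
  ... | _ , _ , refl with new-HasZero m₂
  ... | inj₁ ()
  ... | inj₂ ()

walk-bigrams-Unique : (n : ℕ) → Unique (bigrams (walk n))
walk-bigrams-Unique zero          = []
walk-bigrams-Unique (suc zero)    = []
walk-bigrams-Unique (suc (suc n)) = walk-bigrams-Unique-suc n (walk-bigrams-Unique (suc n))

-- Base codings

boolPairs : List (Bool × Bool)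
boolPairs = (false , false) ∷ (false , true) ∷ (true , true) ∷ []

lzdBase : Coding LZD (Fin 3)
lzdBase = refineLZD (identityCoding LZD) boolPairs fresh unique refl
  where
  fresh : FreshSeconds (λ _ → ⊥) boolPairs
  fresh = (λ ()) , (λ { (inj₁ ()) ; (inj₂ ()) }) , (λ { (inj₁ ()) ; (inj₂ (inj₁ ())) ; (inj₂ (inj₂ ())) }) , _
  unique : Unique boolPairs
  unique = ((λ ()) All.∷ (λ ()) All.∷ All.[]) ∷ ((λ ()) All.∷ All.[]) ∷ All.[] ∷ []

baseCode : Fin 3 → Bool × Bool
baseCode zero             = false , true
baseCode (suc zero)       = true , false
baseCode (suc (suc zero)) = true , true

baseDecode : Bool × Bool → Fin 3
baseDecode (false , _)    = zero
baseDecode (true , false) = suc zero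
baseDecode (true , true)  = suc (suc zero)

baseDecode-baseCode : ∀ c → baseDecode (baseCode c) ≡ c
baseDecode-baseCode zero             = refl
baseDecode-baseCode (suc zero)       = refl
baseDecode-baseCode (suc (suc zero)) = refl

baseCode-injective : ∀ {c c′} → baseCode c ≡ baseCode c′ → c ≡ c′
baseCode-injective {c} {c′} e =
  trans (sym (baseDecode-baseCode c)) (trans (cong baseDecode e) (baseDecode-baseCode c′))

module LZMWBase where
  open PairCode baseCode baseCode-injective

  -- Over Bool no letter is fresh, so the training is given by hand: five single letters put ft, tt,
  -- tf and ff into the dictionary, and the phrase ff ends the training.
  baseWord : List Bool
  baseWord = false ∷ true ∷ true ∷ false ∷ false ∷ false ∷ false ∷ []

  baseLetters : List Bool
  baseLetters = false ∷ true ∷ true ∷ false ∷ false ∷ []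

  basePhrases : List (List Bool)
  basePhrases = map [_] baseLetters ∷ʳ (false ∷ false ∷ [])

  ff-unmatched : (r : List (Fin 3)) → ¬ Prefix (false ∷ false ∷ []) (encode r)
  ff-unmatched []                     (_ , ())
  ff-unmatched (zero ∷ r)             (_ , ())
  ff-unmatched (suc zero ∷ r)         (_ , ())
  ff-unmatched (suc (suc zero) ∷ r)   (_ , ())

  pair∈ : ∀ c → pairWord (baseCode c) ∈ adjPairs basePhrases
  pair∈ zero             = here refl
  pair∈ (suc zero)       = there (there (here refl))
  pair∈ (suc (suc zero)) = there (here refl)

  short : ∀ {z} r → z ∈ adjPairs basePhrases → Prefix z (encode r) → length z ≤ 2
  short r (here refl)                                 _  = ≤-refl
  short r (there (here refl))                         _  = ≤-refl
  short r (there (there (here refl)))                 _  = ≤-refl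
  short r (there (there (there (here refl))))         _  = ≤-refl
  short r (there (there (there (there (here refl))))) pz = ⊥-elim (ff-unmatched r (Prefix-trans (false ∷ [] , refl) pz))

  unmatched : ∀ {qs′ a} r → basePhrases ≡ qs′ ∷ʳ a → ¬ Prefix a (encode r)
  unmatched r e with ∷ʳ-injectiveʳ (map [_] baseLetters) _ e
  ... | refl = ff-unmatched r

  ff-longest : {w : List Bool} →
    LongestPrefix (DictLZMW (map [_] baseLetters)) (false ∷ false ∷ w) (false ∷ false ∷ [])
  ff-longest = inj₁ (there (there (there (here refl)))) , (_ , refl) , λ where
    z (inj₂ (_ , refl)) _ → s≤s z≤n
    z (inj₁ m)          _ → ≤-reflexive (∈-adjPairs-singletons-length baseLetters m)

  baseTraining : {w : List Bool} {rest : List (List Bool)} →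
    LZMWFrom basePhrases w rest → LZMWFrom [] (baseWord ++ w) (basePhrases ++ rest)
  baseTraining d =
    step [ false ] _ _ (letter-longest λ ()) (
    step [ true ]  _ _ (letter-longest λ ()) (
    step [ true ]  _ _ (letter-longest λ { (here refl) (_ , ()) }) (
    step [ false ] _ _ (letter-longest λ { (here refl) (_ , ()) ; (there (here refl)) (_ , ()) }) (
    step [ false ] _ _ (letter-longest λ { (here refl) (_ , ()) ; (there (here refl)) (_ , ())
                                         ; (there (there (here refl))) (_ , ()) }) (
    step (false ∷ false ∷ []) _ _ ff-longest d)))))

  lzmwBase : Coding LZMW (Fin 3)
  lzmwBase = refine (identityCoding LZMW) baseCode baseCode-injective baseWord basePhrases λ s ps d →
    baseTraining (subst (λ P → LZMWFrom P (encode s) (map encode ps)) (++-identityʳ basePhrases)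
      (encode-LZMWFrom pair∈ short unmatched d))

open LZMWBase using (lzmwBase)

suc≤2* : {n : ℕ} → 1 ≤ n → suc n ≤ 2 * n
suc≤2* {n} 1≤n = ≤-trans (+-monoˡ-≤ n 1≤n) (≤-reflexive (cong (n +_) (sym (+-identityʳ n))))

suc[m*m∸1]≡m*m : {m : ℕ} → 2 ≤ m → suc (m * m ∸ 1) ≡ m * m
suc[m*m∸1]≡m*m {suc m} _ = refl

square-mono-suc : {m : ℕ} → 2 ≤ m → suc m ≤ m * m
square-mono-suc {m} 2≤m = ≤-trans (suc≤2* (≤-trans (s≤s z≤n) 2≤m)) (*-monoˡ-≤ m 2≤m)

suc-square≤4*square : {m : ℕ} → 1 ≤ m → suc m * suc m ≤ 4 * (m * m)
suc-square≤4*square {m} 1≤m =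
  ≤-trans (*-mono-≤ (suc≤2* 1≤m) (suc≤2* 1≤m))
    (≤-reflexive (solve 1 (λ m → (con 2 :* m) :* (con 2 :* m) := con 4 :* (m :* m)) refl m))
  where open +-*-Solver

2^suc≡2^+2^ : (n : ℕ) → 2 ^ suc n ≡ 2 ^ n + 2 ^ n
2^suc≡2^+2^ n = cong (2 ^ n +_) (+-identityʳ (2 ^ n))

2^≤⇒≤⌊log₂⌋ : (a k : ℕ) → 2 ^ a ≤ k → a ≤ ⌊log₂ k ⌋
2^≤⇒≤⌊log₂⌋ a k le = subst (_≤ ⌊log₂ k ⌋) (⌊log₂[2^n]⌋≡n a) (⌊log₂⌋-mono-≤ le)

≤2^⇒⌊log₂⌋≤ : (a k : ℕ) → k ≤ 2 ^ a → ⌊log₂ k ⌋ ≤ a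
≤2^⇒⌊log₂⌋≤ a k le = subst (⌊log₂ k ⌋ ≤_) (⌊log₂[2^n]⌋≡n a) (⌊log₂⌋-mono-≤ le)

bracket : (f : ℕ → ℕ) → (∀ j → f j < f (suc j)) → {k : ℕ} → f 0 < k → ∃ λ j → f j < k × k ≤ f (suc j)
bracket f f-strict {k} f0<k = search k 0 f0<k (m≤n+m k (f 0))
  where
  search : ∀ fuel j → f j < k → k ≤ f j + fuel → ∃ λ j → f j < k × k ≤ f (suc j)
  search zero       j fj<k k≤ = ⊥-elim (<⇒≱ fj<k (subst (k ≤_) (+-identityʳ (f j)) k≤))
  search (suc fuel) j fj<k k≤ with k ≤? f (suc j)
  ... | yes k≤f′ = j , fj<k , k≤f′
  ... | no  k≰f′ = search fuel (suc j) (≰⇒> k≰f′)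
                     (≤-trans k≤ (≤-trans (≤-reflexive (+-suc (f j) fuel)) (+-monoˡ-≤ fuel (f-strict j))))

-- Towers of codings

record Tower (sc : Scheme) : Set₁ where
  field
    size                    : ℕ → ℕ
    level                   : (i : ℕ) → Coding sc (Fin (size i))
    sublevel                : (i k : ℕ) → 1 ≤ k → k ≤ size (suc i) → Coding sc (Fin k)
    level-codeLength        : (i : ℕ) → codeLength (level i) ≡ 2 ^ suc i
    sublevel-codeLength     : ∀ i k 1≤k k≤ → codeLength (sublevel i k 1≤k k≤) ≡ 2 * codeLength (level i)
    level₀-training         : length (training (level 0)) ≤ 12
    level-training          : ∀ i → length (training (level (suc i))) ≤
                                length (training (level i)) + 2 * size (suc i) * codeLength (level i)
    sublevel-training-lower : ∀ i k 1≤k k≤ → k * codeLength (level i) ≤ length (training (sublevel i k 1≤k k≤))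
    sublevel-training-upper : ∀ i k 1≤k k≤ → length (training (sublevel i k 1≤k k≤)) ≤
                                length (training (level i)) + 2 * k * codeLength (level i)
    size₀                   : size 0 ≡ 3
    size₂                   : 8 ≤ size 2
    size-mono               : ∀ i → size i ≤ size (suc i)
    size-suc≤size²          : ∀ i → size (suc i) ≤ size i * size i
    size²≤4*size-suc        : ∀ i → size i * size i ≤ 4 * size (suc i)

lzdSize : ℕ → ℕ
lzdSize zero    = 3
lzdSize (suc i) = length (lexPairs (lzdSize i))

lzdLevel : (i : ℕ) → Coding LZD (Fin (lzdSize i))
lzdSublevel : (i k : ℕ) → k ≤ lzdSize (suc i) → Coding LZD (Fin k)

lzdLevel zero    = lzdBase
lzdLevel (suc i) = lzdSublevel i (lzdSize (suc i)) ≤-refl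

lzdSublevel i k k≤ = refineLZD (lzdLevel i) (take k (lexPairs (lzdSize i)))
  (FreshSeconds-take k _ (lexPairs-FreshSeconds _)) (take⁺ k (lexPairs-Unique _)) (length-take-≤ k _ k≤)

lzdLevel-codeLength : (i : ℕ) → codeLength (lzdLevel i) ≡ 2 ^ suc i
lzdLevel-codeLength zero    = refl
lzdLevel-codeLength (suc i) = cong (2 *_) (lzdLevel-codeLength i)

lzdSublevel-training : (i k : ℕ) (k≤ : k ≤ lzdSize (suc i)) →
  length (training (lzdSublevel i k k≤)) ≡ length (training (lzdLevel i)) + 2 * k * codeLength (lzdLevel i)
lzdSublevel-training i k k≤ = length-training-refineLZD (lzdLevel i) (take k (lexPairs (lzdSize i)))
  (FreshSeconds-take k _ (lexPairs-FreshSeconds _)) (take⁺ k (lexPairs-Unique _)) (length-take-≤ k _ k≤)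

lzdTower : Tower LZD
lzdTower = record
  { size                    = lzdSize
  ; level                   = lzdLevel
  ; sublevel                = λ i k _ k≤ → lzdSublevel i k k≤
  ; level-codeLength        = lzdLevel-codeLength
  ; sublevel-codeLength     = λ _ _ _ _ → refl
  ; level₀-training         = m≤m+n 6 6
  ; level-training          = λ i → ≤-reflexive (lzdSublevel-training i _ ≤-refl)
  ; sublevel-training-lower = λ i k _ k≤ → ≤-trans (*-monoˡ-≤ _ (m≤n*m k 2))
                                 (≤-trans (m≤n+m _ _) (≤-reflexive (sym (lzdSublevel-training i k k≤))))
  ; sublevel-training-upper = λ i k _ k≤ → ≤-reflexive (lzdSublevel-training i k k≤)
  ; size₀                   = refl
  ; size₂                   = m≤m+n 8 13
  ; size-mono               = λ i → n≤length-lexPairs (lzdSize i)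
  ; size-suc≤size²          = λ i → length-lexPairs≤ (lzdSize i)
  ; size²≤4*size-suc        = λ i → square≤4*length-lexPairs (lzdSize i)
  }

-- Level i has the letters Fin (suc (lzmwInner i)); zero is reserved to end the next training word.
lzmwInner : ℕ → ℕ
lzmwInner zero    = 2
lzmwInner (suc i) = lzmwInner i * lzmwInner i ∸ 1

2≤lzmwInner : (i : ℕ) → 2 ≤ lzmwInner i
2≤lzmwInner zero    = ≤-refl
2≤lzmwInner (suc i) = ≤-trans (s≤s (s≤s z≤n)) (∸-monoˡ-≤ 1 (*-mono-≤ (2≤lzmwInner i) (2≤lzmwInner i)))

suc-lzmwInner-suc : (i : ℕ) → suc (lzmwInner (suc i)) ≡ lzmwInner i * lzmwInner i
suc-lzmwInner-suc i = suc[m*m∸1]≡m*m (2≤lzmwInner i)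

length-take-walk : (i k : ℕ) → k ≤ suc (lzmwInner (suc i)) → length (take k (walk (lzmwInner i))) ≡ k
length-take-walk i k k≤ =
  length-take-≤ k _ (subst (k ≤_) (trans (suc-lzmwInner-suc i) (sym (length-walk (lzmwInner i)))) k≤)

lzmwLevel : (i : ℕ) → Coding LZMW (Fin (suc (lzmwInner i)))
lzmwSublevel : (i k : ℕ) → k ≤ suc (lzmwInner (suc i)) → Coding LZMW (Fin k)

lzmwLevel zero    = lzmwBase
lzmwLevel (suc i) = lzmwSublevel i (suc (lzmwInner (suc i))) ≤-refl

lzmwSublevel i k k≤ = refineLZMW-lifted (lzmwLevel i) (take k (walk (lzmwInner i)))
  (Unique-bigrams-take k _ (walk-bigrams-Unique _)) (length-take-walk i k k≤)

lzmwLevel-codeLength : (i : ℕ) → codeLength (lzmwLevel i) ≡ 2 ^ suc i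
lzmwLevel-codeLength zero    = refl
lzmwLevel-codeLength (suc i) = cong (2 *_) (lzmwLevel-codeLength i)

lzmwSublevel-training : (i k : ℕ) (k≤ : k ≤ suc (lzmwInner (suc i))) →
  length (training (lzmwSublevel i k k≤)) ≡ length (training (lzmwLevel i)) + suc k * codeLength (lzmwLevel i)
lzmwSublevel-training i k k≤ = length-training-refineLZMW-lifted (lzmwLevel i) (take k (walk (lzmwInner i)))
  (Unique-bigrams-take k _ (walk-bigrams-Unique _)) (length-take-walk i k k≤)

lzmwSublevel-training≤ : (i k : ℕ) → 1 ≤ k → (k≤ : k ≤ suc (lzmwInner (suc i))) →
  length (training (lzmwSublevel i k k≤)) ≤ length (training (lzmwLevel i)) + 2 * k * codeLength (lzmwLevel i)
lzmwSublevel-training≤ i k 1≤k k≤ = begin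
  length (training (lzmwSublevel i k k≤))
    ≡⟨ lzmwSublevel-training i k k≤ ⟩
  length (training (lzmwLevel i)) + suc k * codeLength (lzmwLevel i)
    ≤⟨ +-monoʳ-≤ (length (training (lzmwLevel i))) (*-monoˡ-≤ (codeLength (lzmwLevel i)) (suc≤2* 1≤k)) ⟩
  length (training (lzmwLevel i)) + 2 * k * codeLength (lzmwLevel i) ∎
  where open ≤-Reasoning

lzmwTower : Tower LZMW
lzmwTower = record
  { size                    = λ i → suc (lzmwInner i)
  ; level                   = lzmwLevel
  ; sublevel                = λ i k _ k≤ → lzmwSublevel i k k≤
  ; level-codeLength        = lzmwLevel-codeLength
  ; sublevel-codeLength     = λ _ _ _ _ → refl
  ; level₀-training         = m≤m+n 7 5
  ; level-training          = λ i → lzmwSublevel-training≤ i _ (s≤s z≤n) ≤-refl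
  ; sublevel-training-lower = λ i k _ k≤ → ≤-trans (m≤n+m (k * codeLength (lzmwLevel i)) (codeLength (lzmwLevel i)))
                                 (≤-trans (m≤n+m _ (length (training (lzmwLevel i))))
                                   (≤-reflexive (sym (lzmwSublevel-training i k k≤))))
  ; sublevel-training-upper = lzmwSublevel-training≤
  ; size₀                   = refl
  ; size₂                   = m≤m+n 8 1
  ; size-mono               = λ i → ≤-trans (square-mono-suc (2≤lzmwInner i)) (≤-reflexive (sym (suc-lzmwInner-suc i)))
  ; size-suc≤size²          = λ i → ≤-trans (≤-reflexive (suc-lzmwInner-suc i))
                                      (*-mono-≤ (n≤1+n (lzmwInner i)) (n≤1+n (lzmwInner i)))
  ; size²≤4*size-suc        = λ i → ≤-trans (suc-square≤4*square (≤-trans (s≤s z≤n) (2≤lzmwInner i)))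
                                      (≤-reflexive (cong (4 *_) (sym (suc-lzmwInner-suc i))))
  }

tower : (sc : Scheme) → Tower sc
tower LZD  = lzdTower
tower LZMW = lzmwTower

-- Size bounds

WellSized : {sc : Scheme} (c k : ℕ) → Coding sc (Fin k) → Set
WellSized c k L =
  (k * ⌊log₂ k ⌋ ≤ c * length (training L)) × (length (training L) ≤ c * (k * ⌊log₂ k ⌋)) ×
  (⌊log₂ k ⌋ ≤ c * codeLength L) × (codeLength L ≤ c * ⌊log₂ k ⌋)

module TowerBounds {sc : Scheme} (T : Tower sc) where
  open Tower T
  open +-*-Solver

  size-upper : (j : ℕ) → size j ≤ 2 ^ (2 ^ suc j)
  size-upper zero    = subst (_≤ 4) (sym size₀) (s≤s (s≤s (s≤s z≤n)))
  size-upper (suc j) = begin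
    size (suc j)                       ≤⟨ size-suc≤size² j ⟩
    size j * size j                    ≤⟨ *-mono-≤ (size-upper j) (size-upper j) ⟩
    2 ^ (2 ^ suc j) * 2 ^ (2 ^ suc j)  ≡⟨ sym (^-distribˡ-+-* 2 (2 ^ suc j) (2 ^ suc j)) ⟩
    2 ^ (2 ^ suc j + 2 ^ suc j)        ≡⟨ cong (2 ^_) (sym (2^suc≡2^+2^ (suc j))) ⟩
    2 ^ (2 ^ suc (suc j))              ∎
    where open ≤-Reasoning

  size-lower : (j : ℕ) → 2 ^ (2 ^ j + 2) ≤ size (2 + j)
  size-lower zero    = size₂
  size-lower (suc j) = *-cancelˡ-≤ 4 (begin
    4 * 2 ^ (2 ^ suc j + 2)            ≡⟨ sym (^-distribˡ-+-* 2 2 (2 ^ suc j + 2)) ⟩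
    2 ^ (2 + (2 ^ suc j + 2))          ≡⟨ cong (2 ^_) exponent ⟩
    2 ^ ((2 ^ j + 2) + (2 ^ j + 2))    ≡⟨ ^-distribˡ-+-* 2 (2 ^ j + 2) (2 ^ j + 2) ⟩
    2 ^ (2 ^ j + 2) * 2 ^ (2 ^ j + 2)  ≤⟨ *-mono-≤ (size-lower j) (size-lower j) ⟩
    size (2 + j) * size (2 + j)        ≤⟨ size²≤4*size-suc (2 + j) ⟩
    4 * size (3 + j)                   ∎)
    where
    open ≤-Reasoning
    exponent : 2 + (2 ^ suc j + 2) ≡ (2 ^ j + 2) + (2 ^ j + 2)
    exponent = trans (cong (λ x → 2 + (x + 2)) (2^suc≡2^+2^ j))
      (solve 1 (λ x → con 2 :+ ((x :+ x) :+ con 2) := (x :+ con 2) :+ (x :+ con 2)) refl (2 ^ j))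

  8≤size : (j : ℕ) → 8 ≤ size (2 + j)
  8≤size zero    = size₂
  8≤size (suc j) = ≤-trans (8≤size j) (size-mono (2 + j))

  size-doubling : (j : ℕ) → 2 * size (2 + j) ≤ size (3 + j)
  size-doubling j = *-cancelˡ-≤ 4 (begin
    4 * (2 * size (2 + j))       ≡⟨ sym (*-assoc 4 2 (size (2 + j))) ⟩
    8 * size (2 + j)             ≤⟨ *-monoˡ-≤ (size (2 + j)) (8≤size j) ⟩
    size (2 + j) * size (2 + j)  ≤⟨ size²≤4*size-suc (2 + j) ⟩
    4 * size (3 + j)             ∎)
    where open ≤-Reasoning

  size-strict : (j : ℕ) → size (2 + j) < size (3 + j)
  size-strict j = ≤-trans (suc≤2* (≤-trans (s≤s z≤n) (8≤size j))) (size-doubling j)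

  level-training≤ : (i : ℕ) → length (training (level i)) ≤ 2 ^ suc (suc i) * size i
  level-training≤ zero    = subst (λ n → length (training (level 0)) ≤ 4 * n) (sym size₀) level₀-training
  level-training≤ (suc i) = begin
    length (training (level (suc i)))
      ≤⟨ level-training i ⟩
    length (training (level i)) + 2 * size (suc i) * codeLength (level i)
      ≤⟨ +-mono-≤ (level-training≤ i) (≤-reflexive (cong (2 * size (suc i) *_) (level-codeLength i))) ⟩
    2 ^ suc (suc i) * size i + 2 * size (suc i) * 2 ^ suc i
      ≤⟨ +-monoˡ-≤ _ (*-monoʳ-≤ (2 ^ suc (suc i)) (size-mono i)) ⟩
    2 ^ suc (suc i) * size (suc i) + 2 * size (suc i) * 2 ^ suc i
      ≡⟨ solve 2 (λ x n → con 2 :* x :* n :+ con 2 :* n :* x := con 2 :* (con 2 :* x) :* n) refl (2 ^ suc i) (size (suc i)) ⟩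
    2 ^ suc (suc (suc i)) * size (suc i) ∎
    where open ≤-Reasoning

  -- size (2 + j) is doubly exponential in j, so for size (2 + j) < k ≤ size (3 + j) both ⌊log₂ k ⌋
  -- and the code length 2 ^ (4 + j) of the k-letter sublevel lie between 2 ^ j and 2 ^ (4 + j).
  module _ (j k : ℕ) (lower : size (2 + j) < k) (upper : k ≤ size (3 + j)) where

    bracketedCoding : Coding sc (Fin k)
    bracketedCoding = sublevel (2 + j) k (≤-trans (s≤s z≤n) lower) upper

    private
      ℓ : ℕ
      ℓ = codeLength bracketedCoding

      t : List Bool
      t = training bracketedCoding

      ℓ≡ : ℓ ≡ 2 * 2 ^ (3 + j)
      ℓ≡ = trans (sublevel-codeLength (2 + j) k _ upper) (cong (2 *_) (level-codeLength (2 + j)))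

    ⌊log₂⌋≤codeLength : ⌊log₂ k ⌋ ≤ ℓ
    ⌊log₂⌋≤codeLength =
      subst (⌊log₂ k ⌋ ≤_) (sym ℓ≡) (≤2^⇒⌊log₂⌋≤ _ k (≤-trans upper (size-upper (3 + j))))

    codeLength≤16*⌊log₂⌋ : ℓ ≤ 16 * ⌊log₂ k ⌋
    codeLength≤16*⌊log₂⌋ = subst (_≤ 16 * ⌊log₂ k ⌋) (sym (trans ℓ≡ (^-distribˡ-+-* 2 4 j)))
      (*-monoʳ-≤ 16 (2^≤⇒≤⌊log₂⌋ (2 ^ j) k
        (≤-trans (^-monoʳ-≤ 2 (m≤m+n (2 ^ j) 2)) (≤-trans (size-lower j) (<⇒≤ lower)))))

    k*⌊log₂⌋≤2*training : k * ⌊log₂ k ⌋ ≤ 2 * length t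
    k*⌊log₂⌋≤2*training = begin
      k * ⌊log₂ k ⌋            ≤⟨ *-monoʳ-≤ k ⌊log₂⌋≤codeLength ⟩
      k * ℓ                    ≡⟨ cong (k *_) ℓ≡ ⟩
      k * (2 * 2 ^ (3 + j))    ≡⟨ solve 2 (λ k x → k :* (con 2 :* x) := con 2 :* (k :* x)) refl k (2 ^ (3 + j)) ⟩
      2 * (k * 2 ^ (3 + j))    ≤⟨ *-monoʳ-≤ 2 (subst (λ x → k * x ≤ length t) (level-codeLength (2 + j))
                                    (sublevel-training-lower (2 + j) k _ upper)) ⟩
      2 * length t             ∎
      where open ≤-Reasoning

    training≤32*k*⌊log₂⌋ : length t ≤ 32 * (k * ⌊log₂ k ⌋)
    training≤32*k*⌊log₂⌋ = begin
      length t
        ≤⟨ sublevel-training-upper (2 + j) k _ upper ⟩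
      length (training (level (2 + j))) + 2 * k * codeLength (level (2 + j))
        ≤⟨ +-mono-≤ (level-training≤ (2 + j)) (≤-reflexive (cong (2 * k *_) (level-codeLength (2 + j)))) ⟩
      2 ^ (4 + j) * size (2 + j) + 2 * k * 2 ^ (3 + j)
        ≤⟨ +-monoˡ-≤ _ (*-monoʳ-≤ (2 ^ (4 + j)) (<⇒≤ lower)) ⟩
      2 * 2 ^ (3 + j) * k + 2 * k * 2 ^ (3 + j)
        ≡⟨ solve 2 (λ x k → con 2 :* x :* k :+ con 2 :* k :* x := con 2 :* (k :* (con 2 :* x))) refl (2 ^ (3 + j)) k ⟩
      2 * (k * (2 * 2 ^ (3 + j)))
        ≡⟨ cong (λ x → 2 * (k * x)) (sym ℓ≡) ⟩
      2 * (k * ℓ)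
        ≤⟨ *-monoʳ-≤ 2 (*-monoʳ-≤ k codeLength≤16*⌊log₂⌋) ⟩
      2 * (k * (16 * ⌊log₂ k ⌋))
        ≡⟨ solve 2 (λ k l → con 2 :* (k :* (con 16 :* l)) := con 32 :* (k :* l)) refl k ⌊log₂ k ⌋ ⟩
      32 * (k * ⌊log₂ k ⌋) ∎
      where open ≤-Reasoning

  wellSizedCoding : (k : ℕ) → size 2 < k → Σ (Coding sc (Fin k)) (WellSized 32 k)
  wellSizedCoding k size₂<k with bracket (λ j → size (2 + j)) size-strict size₂<k
  ... | j , lower , upper =
    bracketedCoding j k lower upper ,
    ≤-trans (k*⌊log₂⌋≤2*training j k lower upper)
      (*-monoˡ-≤ (length (training (bracketedCoding j k lower upper))) (m≤m+n 2 30)) ,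
    training≤32*k*⌊log₂⌋ j k lower upper ,
    ≤-trans (⌊log₂⌋≤codeLength j k lower upper) (m≤n*m _ 32) ,
    ≤-trans (codeLength≤16*⌊log₂⌋ j k lower upper) (*-monoˡ-≤ ⌊log₂ k ⌋ (m≤m+n 16 16))

lemma4 : (sc : Scheme) →
  Σ ℕ λ c → Σ ℕ λ N →
    (k : ℕ) → N ≤ k → (s : List (Fin k)) →
      Σ (List Bool) λ t → Σ ℕ λ ℓ → Σ (List (Fin k) → List Bool) λ φ →
        (k * ⌊log₂ k ⌋ ≤ c * length t) × (length t ≤ c * (k * ⌊log₂ k ⌋)) ×
        (⌊log₂ k ⌋ ≤ c * ℓ) × (ℓ ≤ c * ⌊log₂ k ⌋) ×
        IsMorphism φ × ((a : Fin k) → length (φ (a ∷ [])) ≡ ℓ) ×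
        ((ps : List (List (Fin k))) → (qs : List (List Bool)) →
          IsParsing sc s ps → IsParsing sc t qs →
          IsParsing sc (t ++ φ s) (qs ++ map φ ps))
lemma4 sc = 32 , suc (Tower.size (tower sc) 2) , λ k size₂<k s →
  let L , t-lower , t-upper , ℓ-lower , ℓ-upper = TowerBounds.wellSizedCoding (tower sc) k size₂<k
  in training L , codeLength L , code L , t-lower , t-upper , ℓ-lower , ℓ-upper ,
     code-++ L , code-letter L , Coding-parses L s
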